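{- Let $k\geq 3$ be an odd integer, $G=\langle x,y:~x^{4k}=y^2=e,~yxy=x^{ -1}\rangle$, $A_0=\langle x^{2k}\rangle$, $A_1=\langle x^4\rangle$, $B=\langle y\rangle$, $U=(A_0\times A_1)B$, $Z=x^2A_1\cup y(A_1\setminus\{x^{2(k-1)}\})\cup\{yx^{2k-1},yx^{ -2},yx^{ -1}\}$ and $\Sigma=\mathrm{Cay}(G,Z)$. Then the WL-closure of $\Sigma$ is the S-ring over $G$ whose basic sets are exactly the singletons $\{g\}$ for $g\in U$ and the sets $gxA_0=\{gx,gx^{2k+1}\}$ for $g\in U$.
   Context: $\mathrm{Cay}(G,S)$ has vertex set $G$ and edges $\{g,sg\}$. For $X\subseteq G$, $\underline{X}=\sum_{x\in X}x$. An S-ring over $G$ is a subring $\mathcal{A}\subseteq\mathbb{Z}G$ spanned by $\underline{X}$, $X$ ranging over a partition of $G$ (basic sets) containing $\{e\}$ and closed under inversion. The WL-closure of $\mathrm{Cay}(G,S)$ is the smallest S-ring over $G$ in which $S$ is a union of basic sets. -}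

module Defs where

open import Data.Nat using (ℕ; zero; suc; _+_; _*_; _∸_; NonZero; _%_)
open import Data.Nat.Properties using (m*n≢0)
open import Data.Nat.DivMod using (_mod_)
open import Data.Fin using (Fin; toℕ; fromℕ<)
open import Data.Fin.Properties using () renaming (_≟_ to _≟ᶠ_)
open import Data.Bool using (Bool; true; false; _xor_)
open import Data.Bool.Properties using () renaming (_≟_ to _≟ᵇ_)
open import Data.List using (List; length; filter; cartesianProduct; allFin; _∷_; [])
open import Data.Product using (Σ; ∃; _×_; _,_; proj₁; proj₂)
open import Data.Product.Properties using (≡-dec)
open import Data.Sum using (_⊎_)
open import Relation.Nullary using (¬_; Dec)
open import Relation.Nullary.Decidable using (_×-dec_)
open import Relation.Binary using (Decidable; IsEquivalence)
open import Relation.Binary.PropositionalEquality using (_≡_; _≢_)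

-- The group G = ⟨x, y : x^(4k) = y^2 = e, yxy = x^(-1)⟩ (dihedral of order 8k).
-- An element (i , b) stands for the normal form  y^b x^i,  i ∈ ℤ/4kℤ.
module Dihedral (k : ℕ) .{{_ : NonZero k}} where

  n : ℕ
  n = 4 * k

  instance
    n≢0 : NonZero n
    n≢0 = m*n≢0 4 k

  red : ℕ → Fin n
  red m = m mod n

  G : Set
  G = Fin n × Bool

  infix 4 _≟G_
  _≟G_ : (g h : G) → Dec (g ≡ h)
  _≟G_ = ≡-dec _≟ᶠ_ _≟ᵇ_

  -- (y^a x^i)(y^b x^j) = y^(a+b) x^((-1)^b i + j), using x^i y = y x^(-i)
  infixl 7 _∙_
  _∙_ : G → G → G
  (i , a) ∙ (j , false) = red (toℕ i + toℕ j) , a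
  (i , a) ∙ (j , true)  = red ((n ∸ toℕ i) + toℕ j) , (a xor true)

  e : G
  e = red 0 , false

  -- inverse: (x^i)^(-1) = x^(-i), (y x^i)^(-1) = x^(-i) y = y x^i
  _⁻¹ : G → G
  (i , false) ⁻¹ = red (n ∸ toℕ i) , false
  (i , true)  ⁻¹ = i , true

  x^ : ℕ → G
  x^ m = red m , false

  x^- : ℕ → G
  x^- m = (x^ m) ⁻¹

  y : G
  y = red 0 , true

  y^ : Bool → G
  y^ false = e
  y^ true  = y

  allG : List G
  allG = cartesianProduct (allFin n) (true ∷ false ∷ [])

  _∈A₀ : G → Set
  g ∈A₀ = ∃ λ i → g ≡ x^ (2 * k * i)

  _∈A₁ : G → Set
  g ∈A₁ = ∃ λ j → g ≡ x^ (4 * j)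

  _∈B : G → Set
  g ∈B = ∃ λ b → g ≡ y^ b

  _∈U : G → Set
  g ∈U = ∃ λ a₀ → ∃ λ a₁ → ∃ λ b → a₀ ∈A₀ × a₁ ∈A₁ × b ∈B × g ≡ a₀ ∙ a₁ ∙ b

  _∈Z : G → Set
  g ∈Z = (∃ λ a → a ∈A₁ × g ≡ x^ 2 ∙ a)
       ⊎ (∃ λ a → a ∈A₁ × a ≢ x^ (2 * (k ∸ 1)) × g ≡ y ∙ a)
       ⊎ g ≡ y ∙ x^ (2 * k ∸ 1)
       ⊎ g ≡ y ∙ x^- 2
       ⊎ g ≡ y ∙ x^- 1

  -- A partition of G is given by its equivalence relation R ("lie in the same
  -- basic set"), required decidable so that basic sets can be counted.
  -- Coefficient of g in  X̲ · Y̲  where X = class of r, Y = class of s: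
  -- the number of pairs (a , b) ∈ X × Y with a b = g.
  coeff : (R : G → G → Set) → Decidable R → G → G → G → ℕ
  coeff R R? r s g =
    length (filter (λ p → (R? r (proj₁ p) ×-dec R? s (proj₂ p)) ×-dec ((proj₁ p ∙ proj₂ p) ≟G g))
                   (cartesianProduct allG allG))

  -- The partition R defines an S-ring: {e} is a basic set, the partition is closed
  -- under inversion, and the ℤ-span of the X̲ is closed under multiplication,
  -- i.e. each product X̲ Y̲ has coefficients constant on every basic set.
  record IsSRing (R : G → G → Set) : Set where
    field
      isEquivalence : IsEquivalence R
      R?            : Decidable R
      unit-basic    : ∀ g → R e g → g ≡ e
      inv-closed    : ∀ g h → R g h → R (g ⁻¹) (h ⁻¹)
      mul-closed    : ∀ r s g h → R g h → coeff R R? r s g ≡ coeff R R? r s h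

  UnionOfBasic : (R : G → G → Set) → (G → Set) → Set
  UnionOfBasic R S = ∀ g h → R g h → S g → S h

  -- The WL-closure of Cay(G,S) is the S-ring with partition R: R is an S-ring in
  -- which S is a union of basic sets, and it is contained in every such S-ring
  -- (A_R ⊆ A_Q  iff every basic set of R is a union of basic sets of Q,
  --  iff Q-equivalence implies R-equivalence).
  IsWLClosure : (R : G → G → Set) → (G → Set) → Set₁
  IsWLClosure R S =
    IsSRing R × UnionOfBasic R S ×
    (∀ (Q : G → G → Set) → IsSRing Q → UnionOfBasic Q S → ∀ g h → Q g h → R g h)

  SameBasic : G → G → Set
  SameBasic g h =
    (g ∈U × h ≡ g)
    ⊎ (∃ λ u → u ∈U × (∃ λ a → a ∈A₀ × g ≡ u ∙ x^ 1 ∙ a) × (∃ λ a → a ∈A₀ × h ≡ u ∙ x^ 1 ∙ a))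

module Submission where

open import Defs
open import Data.Nat using (ℕ; NonZero; _≤_)
open import Data.Nat.Divisibility using (_∣_)
open import Relation.Nullary using (¬_)
open import Data.Product using (_,_)

-- The partition into the singletons of U (the elements y^b x^i with i even) and the pairs
-- {g, g z}, z = x^(2k), for g ∉ U is an S-ring in which Z is a union of basic sets: z is
-- central, so pushing it onto an odd factor matches the factorisations of g with those of
-- g z.  Conversely, let Z be a union of basic sets of some S-ring.  The element t = y x⁻² is
-- the only element of Z that is a product of two elements of Z in three ways, so {t} is a
-- basic set.  Multiplying by t then singles out {z, s₁, s₂}, of which z alone keeps t z t in
-- Z ∖ {t}, then {s₁, s₂} = {y x^(2k-1), y x⁻¹}, the set t z {s₁, s₂} = {x, x z} and
-- Z ∩ {x, x z}² = {x²}.  Hence x², and with it every element of U, is thin, and the basic set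
-- of g ∉ U lies in (g x⁻¹){x, x z} = {g, g z}.  All computations inside Z only depend on the
-- image of G in the dihedral group of order 8, where they are finite.

module FiniteSums where

  open import Data.Nat using (ℕ; zero; suc; _+_; _*_; _≤_; _<_; z≤n; s≤s)
  open import Data.Nat.Properties
  open import Data.Nat.Tactic.RingSolver using (solve-∀)
  open import Data.Bool using (true; false; if_then_else_)
  open import Data.Fin using (Fin; zero; suc)
  import Data.Fin.Properties as Fin
  open import Data.List using (List; []; _∷_; _++_; map; filter; length; cartesianProduct; allFin; tabulate)
  open import Data.Nat.ListAction using (sum)
  open import Data.Nat.ListAction.Properties using (sum-++)
  import Data.List.Properties as List
  open import Data.Product using (∃; _×_; _,_; proj₁; proj₂)
  open import Function using (_∘_; id)
  open import Relation.Nullary using (Dec; yes; no; does; ¬_; contradiction)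
  open import Relation.Nullary.Decidable using (_×-dec_)
  open import Relation.Unary using (Pred; Decidable)
  open import Relation.Binary.Definitions using (DecidableEquality)
  open import Relation.Binary.PropositionalEquality

  𝟙 : ∀ {P : Set} → Dec P → ℕ
  𝟙 P? = if does P? then 1 else 0

  private variable
    P Q : Set

  𝟙-yes : (P? : Dec P) → P → 𝟙 P? ≡ 1
  𝟙-yes (yes _) _ = refl
  𝟙-yes (no ¬p) p = contradiction p ¬p

  𝟙-no : (P? : Dec P) → ¬ P → 𝟙 P? ≡ 0
  𝟙-no (yes p) ¬p = contradiction p ¬p
  𝟙-no (no _)  _  = refl

  𝟙-pos : (P? : Dec P) → 0 < 𝟙 P? → P
  𝟙-pos (yes p) _ = p

  𝟙-cong : (P? : Dec P) (Q? : Dec Q) → (P → Q) → (Q → P) → 𝟙 P? ≡ 𝟙 Q?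
  𝟙-cong (yes p) Q? f g = sym (𝟙-yes Q? (f p))
  𝟙-cong (no ¬p) Q? f g = sym (𝟙-no Q? (¬p ∘ g))

  𝟙-× : (P? : Dec P) (Q? : Dec Q) → 𝟙 (P? ×-dec Q?) ≡ 𝟙 P? * 𝟙 Q?
  𝟙-× (yes _) Q? = sym (+-identityʳ (𝟙 Q?))
  𝟙-× (no _)  Q? = refl

  module _ {A : Set} where

    ∑ : List A → (A → ℕ) → ℕ
    ∑ xs f = sum (map f xs)

    ∑-cong : ∀ xs {f g : A → ℕ} → (∀ x → f x ≡ g x) → ∑ xs f ≡ ∑ xs g
    ∑-cong xs f≗g = cong sum (List.map-cong f≗g xs)

    ∑-mono-≤ : ∀ xs {f g : A → ℕ} → (∀ x → f x ≤ g x) → ∑ xs f ≤ ∑ xs g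
    ∑-mono-≤ []       f≤g = z≤n
    ∑-mono-≤ (x ∷ xs) f≤g = +-mono-≤ (f≤g x) (∑-mono-≤ xs f≤g)

    ∑-zero : ∀ xs → ∑ xs (λ _ → 0) ≡ 0
    ∑-zero []       = refl
    ∑-zero (x ∷ xs) = ∑-zero xs

    ∑-distrib-+ : ∀ xs (f g : A → ℕ) → ∑ xs (λ x → f x + g x) ≡ ∑ xs f + ∑ xs g
    ∑-distrib-+ []       f g = refl
    ∑-distrib-+ (x ∷ xs) f g =
      trans (cong (f x + g x +_) (∑-distrib-+ xs f g)) (interchange (f x) (g x) (∑ xs f) (∑ xs g))
      where
      interchange : ∀ a b c d → a + b + (c + d) ≡ a + c + (b + d)
      interchange = solve-∀

    ∑-*ˡ : ∀ xs c (f : A → ℕ) → ∑ xs (λ x → c * f x) ≡ c * ∑ xs f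
    ∑-*ˡ []       c f = sym (*-zeroʳ c)
    ∑-*ˡ (x ∷ xs) c f = trans (cong (c * f x +_) (∑-*ˡ xs c f)) (sym (*-distribˡ-+ c (f x) (∑ xs f)))

    ∑-*ʳ : ∀ xs c (f : A → ℕ) → ∑ xs (λ x → f x * c) ≡ ∑ xs f * c
    ∑-*ʳ xs c f = trans (∑-cong xs (λ x → *-comm (f x) c)) (trans (∑-*ˡ xs c f) (*-comm c (∑ xs f)))

    ∑-pos : ∀ xs (f : A → ℕ) → 0 < ∑ xs f → ∃ λ x → 0 < f x
    ∑-pos (x ∷ xs) f 0<∑ with f x in fx
    ... | suc _ = x , subst (0 <_) (sym fx) (s≤s z≤n)
    ... | zero  = ∑-pos xs f 0<∑

    length-filter : {P : Pred A _} (P? : Decidable P) (xs : List A) → length (filter P? xs) ≡ ∑ xs (𝟙 ∘ P?)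
    length-filter P? []       = refl
    length-filter P? (x ∷ xs) with does (P? x)
    ... | true  = cong suc (length-filter P? xs)
    ... | false = length-filter P? xs

  ∑-map : ∀ {A B : Set} (g : A → B) xs (f : B → ℕ) → ∑ (map g xs) f ≡ ∑ xs (f ∘ g)
  ∑-map g xs f = cong sum (sym (List.map-∘ xs))

  ∑-swap : ∀ {A B : Set} (xs : List A) (ys : List B) (f : A → B → ℕ) →
           ∑ xs (λ x → ∑ ys (f x)) ≡ ∑ ys (λ y → ∑ xs (λ x → f x y))
  ∑-swap []       ys f = sym (∑-zero ys)
  ∑-swap (x ∷ xs) ys f = trans (cong (∑ ys (f x) +_) (∑-swap xs ys f)) (sym (∑-distrib-+ ys (f x) _))

  ∑-cartesianProduct : ∀ {A B : Set} (xs : List A) (ys : List B) (f : A × B → ℕ) →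
                       ∑ (cartesianProduct xs ys) f ≡ ∑ xs (λ x → ∑ ys (λ y → f (x , y)))
  ∑-cartesianProduct []       ys f = refl
  ∑-cartesianProduct (x ∷ xs) ys f = begin
    ∑ (map (x ,_) ys ++ cartesianProduct xs ys) f ≡⟨ cong sum (List.map-++ f (map (x ,_) ys) _) ⟩
    sum (map f (map (x ,_) ys) ++ map f (cartesianProduct xs ys)) ≡⟨ sum-++ (map f (map (x ,_) ys)) _ ⟩
    ∑ (map (x ,_) ys) f + ∑ (cartesianProduct xs ys) f ≡⟨ cong₂ _+_ (∑-map (x ,_) ys f) (∑-cartesianProduct xs ys f) ⟩
    ∑ ys (λ y → f (x , y)) + ∑ xs (λ x → ∑ ys (λ y → f (x , y))) ∎
    where open ≡-Reasoning

  record Enumerates {A : Set} (_≟_ : DecidableEquality A) (xs : List A) : Set where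
    constructor enumerates
    field occurs-once : ∀ c → ∑ xs (λ x → 𝟙 (c ≟ x)) ≡ 1

  module _ {A : Set} {_≟_ : DecidableEquality A} {xs : List A} (enum : Enumerates _≟_ xs) where

    open Enumerates enum

    ∑-select : ∀ c (f : A → ℕ) → ∑ xs (λ x → 𝟙 (c ≟ x) * f x) ≡ f c
    ∑-select c f = begin
      ∑ xs (λ x → 𝟙 (c ≟ x) * f x) ≡⟨ ∑-cong xs δf≗δfc ⟩
      ∑ xs (λ x → 𝟙 (c ≟ x) * f c) ≡⟨ ∑-*ʳ xs (f c) _ ⟩
      ∑ xs (λ x → 𝟙 (c ≟ x)) * f c ≡⟨ cong (_* f c) (occurs-once c) ⟩
      1 * f c                      ≡⟨ *-identityˡ (f c) ⟩
      f c                          ∎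
      where
      open ≡-Reasoning
      δf≗δfc : ∀ x → 𝟙 (c ≟ x) * f x ≡ 𝟙 (c ≟ x) * f c
      δf≗δfc x with c ≟ x
      ... | yes refl = refl
      ... | no  _    = refl

    ≤-∑ : ∀ c (f : A → ℕ) → f c ≤ ∑ xs f
    ≤-∑ c f = subst (_≤ ∑ xs f) (∑-select c f) (∑-mono-≤ xs δf≤f)
      where
      δf≤f : ∀ x → 𝟙 (c ≟ x) * f x ≤ f x
      δf≤f x with c ≟ x
      ... | yes _ = ≤-reflexive (+-identityʳ (f x))
      ... | no  _ = z≤n

    ∑-occurrences : ∀ cs → ∑ xs (λ x → ∑ cs (λ c → 𝟙 (c ≟ x))) ≡ length cs
    ∑-occurrences cs = trans (∑-swap xs cs _) (all-once cs)
      where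
      all-once : ∀ cs → ∑ cs (λ c → ∑ xs (λ x → 𝟙 (c ≟ x))) ≡ length cs
      all-once []       = refl
      all-once (c ∷ cs) = cong₂ _+_ (occurs-once c) (all-once cs)

    length≤∑ : ∀ cs {f : A → ℕ} → (∀ x → ∑ cs (λ c → 𝟙 (c ≟ x)) ≤ f x) → length cs ≤ ∑ xs f
    length≤∑ cs occ≤f = subst (_≤ ∑ xs _) (∑-occurrences cs) (∑-mono-≤ xs occ≤f)

    ∑≤length : ∀ cs {f : A → ℕ} → (∀ x → f x ≤ ∑ cs (λ c → 𝟙 (c ≟ x))) → ∑ xs f ≤ length cs
    ∑≤length cs f≤occ = subst (∑ xs _ ≤_) (∑-occurrences cs) (∑-mono-≤ xs f≤occ)

    ∑-involution : ∀ (σ : A → A) → (∀ a → σ (σ a) ≡ a) → (f : A → ℕ) → ∑ xs (f ∘ σ) ≡ ∑ xs f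
    ∑-involution σ σσ f = begin
      ∑ xs (f ∘ σ)                                     ≡⟨ ∑-cong xs (λ a → ∑-select (σ a) f) ⟨
      ∑ xs (λ a → ∑ xs (λ c → 𝟙 (σ a ≟ c) * f c))     ≡⟨ ∑-swap xs xs _ ⟩
      ∑ xs (λ c → ∑ xs (λ a → 𝟙 (σ a ≟ c) * f c))     ≡⟨ ∑-cong xs (λ c → ∑-*ʳ xs (f c) _) ⟩
      ∑ xs (λ c → ∑ xs (λ a → 𝟙 (σ a ≟ c)) * f c)     ≡⟨ ∑-cong xs (λ c → cong (_* f c) (preimage-once c)) ⟩
      ∑ xs (λ c → 1 * f c)                             ≡⟨ ∑-cong xs (λ c → *-identityˡ (f c)) ⟩
      ∑ xs f                                           ∎
      where
      open ≡-Reasoning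
      preimage-once : ∀ c → ∑ xs (λ a → 𝟙 (σ a ≟ c)) ≡ 1
      preimage-once c = trans (∑-cong xs λ a → 𝟙-cong (σ a ≟ c) (σ c ≟ a)
                          (λ σa≡c → trans (cong σ (sym σa≡c)) (σσ a))
                          (λ σc≡a → trans (cong σ (sym σc≡a)) (σσ c)))
                        (occurs-once (σ c))

  allFin-enumerates : ∀ n → Enumerates Fin._≟_ (allFin n)
  allFin-enumerates n = enumerates λ c → trans (cong sum (List.map-tabulate {n = n} id (λ i → 𝟙 (c Fin.≟ i)))) (sum-δ n c)
    where
    sum-δ : ∀ n (c : Fin n) → sum (tabulate (λ i → 𝟙 (c Fin.≟ i))) ≡ 1
    sum-δ (suc n) zero    = cong suc (sum-zero n)
      where
      sum-zero : ∀ n → sum (tabulate {n = n} (λ _ → 0)) ≡ 0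
      sum-zero zero    = refl
      sum-zero (suc n) = sum-zero n
    sum-δ (suc n) (suc c) = sum-δ n c

  cartesianProduct-enumerates : ∀ {A B : Set} {_≟A_ : DecidableEquality A} {_≟B_ : DecidableEquality B}
    (_≟_ : DecidableEquality (A × B)) {xs ys} →
    Enumerates _≟A_ xs → Enumerates _≟B_ ys → Enumerates _≟_ (cartesianProduct xs ys)
  cartesianProduct-enumerates {_≟A_ = _≟A_} {_≟B_} _≟_ {xs} {ys} (enumerates xs-once) (enumerates ys-once) =
    enumerates λ (c , d) → occurs-once c d
    where
    open ≡-Reasoning
    δ-pair : ∀ c d a b → 𝟙 ((c , d) ≟ (a , b)) ≡ 𝟙 (c ≟A a) * 𝟙 (d ≟B b)
    δ-pair c d a b = trans (𝟙-cong ((c , d) ≟ (a , b)) ((c ≟A a) ×-dec (d ≟B b))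
                             (λ eq → cong proj₁ eq , cong proj₂ eq) (λ (c≡a , d≡b) → cong₂ _,_ c≡a d≡b))
                           (𝟙-× (c ≟A a) (d ≟B b))
    occurs-once : ∀ c d → ∑ (cartesianProduct xs ys) (λ p → 𝟙 ((c , d) ≟ p)) ≡ 1
    occurs-once c d = begin
      ∑ (cartesianProduct xs ys) (λ p → 𝟙 ((c , d) ≟ p))   ≡⟨ ∑-cartesianProduct xs ys _ ⟩
      ∑ xs (λ a → ∑ ys (λ b → 𝟙 ((c , d) ≟ (a , b))))      ≡⟨ ∑-cong xs (λ a → ∑-cong ys (δ-pair c d a)) ⟩
      ∑ xs (λ a → ∑ ys (λ b → 𝟙 (c ≟A a) * 𝟙 (d ≟B b)))    ≡⟨ ∑-cong xs (λ a → ∑-*ˡ ys (𝟙 (c ≟A a)) _) ⟩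
      ∑ xs (λ a → 𝟙 (c ≟A a) * ∑ ys (λ b → 𝟙 (d ≟B b)))    ≡⟨ ∑-cong xs (λ a → cong (𝟙 (c ≟A a) *_) (ys-once d)) ⟩
      ∑ xs (λ a → 𝟙 (c ≟A a) * 1)                          ≡⟨ ∑-cong xs (λ a → *-identityʳ _) ⟩
      ∑ xs (λ a → 𝟙 (c ≟A a))                              ≡⟨ xs-once c ⟩
      1                                                    ∎

module IntegerCongruence where

  open import Data.Nat as ℕ using (ℕ; zero; suc; NonZero)
  import Data.Nat.Properties as ℕ
  open import Data.Nat.DivMod using (m≡m%n+[m/n]*n; m%n<n)
  open import Data.Nat.Divisibility using (∣⇒≤)
  open import Data.Integer using (ℤ; +_; _+_; _*_; -_; _-_; ∣_∣)
  open import Data.Integer.Properties using (pos-+; pos-*; +-injective; ∣i∣≡0⇒i≡0; i-j≡0⇒i≡j; m-n≡m⊖n; ∣m⊝n∣≤m⊔n)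
  open import Data.Integer.Divisibility.Signed as ℤ using (divides; ∣-trans; ∣⇒∣ᵤ; ∣m∣n⇒∣m+n; ∣m⇒∣-m)
  open import Data.Integer.Tactic.RingSolver using (solve-∀)
  open import Level using (0ℓ)
  open import Relation.Binary using (Setoid; IsEquivalence)
  open import Relation.Binary.PropositionalEquality
  open import Relation.Nullary using (contradiction)

  infix 4 _≡_[mod_]

  record _≡_[mod_] (a b m : ℤ) : Set where
    constructor congruent
    field divides-difference : m ℤ.∣ a - b

  module _ {m : ℤ} where

    ≡⇒≡-mod : ∀ {a b} → a ≡ b → a ≡ b [mod m ]
    ≡⇒≡-mod {a} refl = congruent (divides (+ 0) (a-a a))
      where
      a-a : ∀ a → a - a ≡ + 0 * m
      a-a = solve-∀

    ≡-mod-sym : ∀ {a b} → a ≡ b [mod m ] → b ≡ a [mod m ]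
    ≡-mod-sym {a} {b} (congruent m∣a-b) = congruent (subst (m ℤ.∣_) (-[a-b] a b) (∣m⇒∣-m m∣a-b))
      where
      -[a-b] : ∀ a b → - (a - b) ≡ b - a
      -[a-b] = solve-∀

    ≡-mod-trans : ∀ {a b c} → a ≡ b [mod m ] → b ≡ c [mod m ] → a ≡ c [mod m ]
    ≡-mod-trans {a} {b} {c} (congruent m∣a-b) (congruent m∣b-c) = congruent (subst (m ℤ.∣_) (telescope a b c) (∣m∣n⇒∣m+n m∣a-b m∣b-c))
      where
      telescope : ∀ a b c → (a - b) + (b - c) ≡ a - c
      telescope = solve-∀

    ≡-mod-isEquivalence : IsEquivalence _≡_[mod m ]
    ≡-mod-isEquivalence = record { refl = ≡⇒≡-mod refl ; sym = ≡-mod-sym ; trans = ≡-mod-trans }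

    ≡-mod-setoid : Setoid 0ℓ 0ℓ
    ≡-mod-setoid = record { isEquivalence = ≡-mod-isEquivalence }

    +-cong-mod : ∀ {a b c d} → a ≡ b [mod m ] → c ≡ d [mod m ] → a + c ≡ b + d [mod m ]
    +-cong-mod {a} {b} {c} {d} (congruent m∣a-b) (congruent m∣c-d) = congruent (subst (m ℤ.∣_) (rearrange a b c d) (∣m∣n⇒∣m+n m∣a-b m∣c-d))
      where
      rearrange : ∀ a b c d → (a - b) + (c - d) ≡ (a + c) - (b + d)
      rearrange = solve-∀

    neg-cong-mod : ∀ {a b} → a ≡ b [mod m ] → - a ≡ - b [mod m ]
    neg-cong-mod {a} {b} (congruent m∣a-b) = congruent (subst (m ℤ.∣_) (-[a-b] a b) (∣m⇒∣-m m∣a-b))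
      where
      -[a-b] : ∀ a b → - (a - b) ≡ - a - - b
      -[a-b] = solve-∀

    ≡-mod-by-quotient : ∀ {a b} q → a ≡ b + q * m → a ≡ b [mod m ]
    ≡-mod-by-quotient {b = b} q refl = congruent (divides q (cancel b q m))
      where
      cancel : ∀ b q m → b + q * m - b ≡ q * m
      cancel = solve-∀

  ≡-mod-divisor : ∀ {d m a b} → d ℤ.∣ m → a ≡ b [mod m ] → a ≡ b [mod d ]
  ≡-mod-divisor d∣m (congruent m∣a-b) = congruent (∣-trans d∣m m∣a-b)

  residue-mod : ∀ d .{{_ : NonZero d}} m → + m ≡ + (m ℕ.% d) [mod + d ]
  residue-mod d m = ≡-mod-by-quotient (+ (m ℕ./ d)) (begin
    + m                               ≡⟨ cong +_ (m≡m%n+[m/n]*n m d) ⟩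
    + (m ℕ.% d ℕ.+ m ℕ./ d ℕ.* d)     ≡⟨ pos-+ (m ℕ.% d) (m ℕ./ d ℕ.* d) ⟩
    + (m ℕ.% d) + + (m ℕ./ d ℕ.* d)   ≡⟨ cong (λ v → + (m ℕ.% d) + v) (pos-* (m ℕ./ d) d) ⟩
    + (m ℕ.% d) + + (m ℕ./ d) * + d   ∎)
    where open ≡-Reasoning

  residue-unique : ∀ {d a b} → a ℕ.< d → b ℕ.< d → + a ≡ + b [mod + d ] → a ≡ b
  residue-unique {d} {a} {b} a<d b<d (congruent d∣a-b) with ∣ + a - + b ∣ in eq | ∣⇒∣ᵤ d∣a-b
  ... | zero  | _  = +-injective (i-j≡0⇒i≡j (+ a) (+ b) (∣i∣≡0⇒i≡0 eq))
  ... | suc r | d∣ = contradiction (∣⇒≤ d∣) (ℕ.<⇒≱ (ℕ.≤-<-trans dist≤max (ℕ.⊔-lub a<d b<d)))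
    where
    dist≤max : suc r ℕ.≤ a ℕ.⊔ b
    dist≤max = subst (ℕ._≤ a ℕ.⊔ b) (trans (cong ∣_∣ (sym (m-n≡m⊖n a b))) eq) (∣m⊝n∣≤m⊔n a b)

  residue-decompose : ∀ d .{{_ : NonZero d}} {m c} → + m ≡ + c [mod + d ] → c ℕ.< d → m ≡ c ℕ.+ d ℕ.* (m ℕ./ d)
  residue-decompose d {m} {c} m≡c c<d = begin
    m                           ≡⟨ m≡m%n+[m/n]*n m d ⟩
    m ℕ.% d ℕ.+ m ℕ./ d ℕ.* d   ≡⟨ cong₂ ℕ._+_ m%d≡c (ℕ.*-comm (m ℕ./ d) d) ⟩
    c ℕ.+ d ℕ.* (m ℕ./ d)       ∎
    where
    open ≡-Reasoning
    m%d≡c : m ℕ.% d ≡ c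
    m%d≡c = residue-unique (m%n<n m d) c<d (≡-mod-trans (≡-mod-sym (residue-mod d m)) m≡c)

module DihedralArithmetic where

  open import Data.Nat as ℕ using (ℕ; NonZero)
  import Data.Nat.Properties as ℕ
  open import Data.Nat.DivMod using (m%n<n)
  open import Data.Integer using (ℤ; +_; _+_; _*_; -_; _-_)
  open import Data.Integer.Properties
    using (*-comm; pos-*; pos-+; m-n≡m⊖n; ⊖-≥; +-assoc; +-identityˡ; +-identityʳ; +-inverseˡ; +-inverseʳ)
  open import Data.Integer.DivMod using (_%ℕ_; _/ℕ_; n%ℕd<d; a≡a%ℕn+[a/ℕn]*n)
  open import Data.Integer.Divisibility.Signed as ℤ using (divides)
  open import Data.Integer.Tactic.RingSolver using (solve-∀)
  open import Data.Bool using (Bool; true; false; _xor_; not)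
  import Data.Bool.Properties as Bool
  open import Data.Bool.Properties using (xor-assoc; xor-identityʳ; xor-same)
  open import Data.Fin using (Fin; toℕ; fromℕ<)
  import Data.Fin.Properties as Fin
  open import Data.Fin.Properties using (toℕ-fromℕ<; toℕ<n; toℕ-injective)
  open import Data.Product using (_×_; _,_; proj₁; proj₂)
  open import Data.Product.Properties using (≡-dec)
  open import Data.List using (List; _∷_; []; cartesianProduct)
  open import Function using (_∋_)
  open import Level using (0ℓ)
  open import Algebra.Bundles using (Group)
  open import Algebra.Structures using (IsGroup)
  open import Relation.Nullary using (Dec; ¬_)
  open import Relation.Nullary.Decidable using (_×-dec_)
  open import Relation.Unary using (Decidable)
  import Relation.Binary
  open import Relation.Binary.PropositionalEquality
  open FiniteSums
  open IntegerCongruence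

  signed : Bool → ℤ → ℤ
  signed false a = a
  signed true  a = - a

  ⌊_⌋ : Bool → ℕ
  ⌊ false ⌋ = 0
  ⌊ true  ⌋ = 1

  module DihedralGroup (k : ℕ) .{{_ : NonZero k}} where

    open Dihedral k public

    K : ℤ
    K = + k

    N : ℤ
    N = + 4 * K

    exp : G → ℤ
    exp (i , _) = + toℕ i

    bit : G → Bool
    bit = proj₂

    ⟨_,_⟩ : ℤ → Bool → G
    ⟨ a , b ⟩ = fromℕ< (n%ℕd<d a n) , b

    private
      +n≡N : + n ≡ N
      +n≡N = pos-* 4 k

      +[n∸i]≡N-i : ∀ (i : Fin n) → + (n ℕ.∸ toℕ i) ≡ N - + toℕ i
      +[n∸i]≡N-i i = trans (sym (⊖-≥ (ℕ.<⇒≤ (toℕ<n i)))) (trans (sym (m-n≡m⊖n n (toℕ i))) (cong (_- + toℕ i) +n≡N))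

      N-a≡-a : ∀ a → N - a ≡ - a [mod N ]
      N-a≡-a a = ≡-mod-by-quotient (+ 1) (N-a a K)
        where
        N-a : ∀ a K → + 4 * K - a ≡ - a + + 1 * (+ 4 * K)
        N-a = solve-∀

    exp-red : ∀ m → + toℕ (red m) ≡ + m [mod N ]
    exp-red m = subst (λ v → + toℕ (red m) ≡ + m [mod v ]) +n≡N
      (subst (λ r → + r ≡ + m [mod + n ]) (sym (toℕ-fromℕ< _)) (≡-mod-sym (residue-mod n m)))

    exp-⟨⟩ : ∀ a b → exp ⟨ a , b ⟩ ≡ a [mod N ]
    exp-⟨⟩ a b = ≡-mod-sym (≡-mod-by-quotient (a /ℕ n) (subst₂ (λ r v → a ≡ + r + (a /ℕ n) * v)
      (sym (toℕ-fromℕ< (n%ℕd<d a n))) +n≡N (a≡a%ℕn+[a/ℕn]*n a n)))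

    ≡-by-exp : ∀ {g h} → exp g ≡ exp h [mod N ] → bit g ≡ bit h → g ≡ h
    ≡-by-exp {i , _} {j , _} i≡j refl = cong (_, _) (toℕ-injective
      (residue-unique (toℕ<n i) (toℕ<n j) (subst (λ v → + toℕ i ≡ + toℕ j [mod v ]) (sym +n≡N) i≡j)))

    ⟨⟩-cong : ∀ {a a'} b → a ≡ a' [mod N ] → ⟨ a , b ⟩ ≡ ⟨ a' , b ⟩
    ⟨⟩-cong {a} {a'} b a≡a' = ≡-by-exp (≡-mod-trans (exp-⟨⟩ a b) (≡-mod-trans a≡a' (≡-mod-sym (exp-⟨⟩ a' b)))) refl

    ⟨⟩-injective : ∀ {a α b β} → ⟨ a , α ⟩ ≡ ⟨ b , β ⟩ → a ≡ b [mod N ]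
    ⟨⟩-injective {a} {α} {b} {β} eq =
      ≡-mod-trans (≡-mod-sym (exp-⟨⟩ a α)) (≡-mod-trans (≡⇒≡-mod (cong exp eq)) (exp-⟨⟩ b β))

    ≢0-mod-N : ∀ {m} → 0 ℕ.< m → m ℕ.< n → ¬ (+ m ≡ + 0 [mod N ])
    ≢0-mod-N 0<m m<n m≡0 = ℕ.<⇒≢ 0<m (sym (residue-unique m<n (ℕ.<-trans 0<m m<n) (subst (λ v → _ ≡ _ [mod v ]) (sym +n≡N) m≡0)))

    ⟨⟩-η : ∀ g → ⟨ exp g , bit g ⟩ ≡ g
    ⟨⟩-η g = ≡-by-exp (exp-⟨⟩ (exp g) (bit g)) refl

    ⟨⟩-elim : ∀ (P : G → Set) → (∀ a b → P ⟨ a , b ⟩) → ∀ g → P g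
    ⟨⟩-elim P P⟨⟩ g = subst P (⟨⟩-η g) (P⟨⟩ (exp g) (bit g))

    exp-∙ : ∀ g h → exp (g ∙ h) ≡ signed (bit h) (exp g) + exp h [mod N ]
    exp-∙ (i , _) (j , false) = ≡-mod-trans (exp-red _) (≡⇒≡-mod (pos-+ (toℕ i) (toℕ j)))
    exp-∙ (i , _) (j , true)  = begin
      + toℕ (red (n ℕ.∸ toℕ i ℕ.+ toℕ j)) ≈⟨ exp-red _ ⟩
      + (n ℕ.∸ toℕ i ℕ.+ toℕ j)           ≡⟨ pos-+ (n ℕ.∸ toℕ i) (toℕ j) ⟩
      + (n ℕ.∸ toℕ i) + + toℕ j           ≡⟨ cong (_+ + toℕ j) (+[n∸i]≡N-i i) ⟩
      N - + toℕ i + + toℕ j               ≈⟨ +-cong-mod (N-a≡-a (+ toℕ i)) (≡⇒≡-mod refl) ⟩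
      - + toℕ i + + toℕ j                 ∎
      where open import Relation.Binary.Reasoning.Setoid (≡-mod-setoid {N})

    bit-∙ : ∀ g h → bit (g ∙ h) ≡ bit g xor bit h
    bit-∙ (_ , false) (_ , false) = refl
    bit-∙ (_ , true)  (_ , false) = refl
    bit-∙ (_ , _)     (_ , true)  = refl

    signed-cong : ∀ b {a a'} → a ≡ a' [mod N ] → signed b a ≡ signed b a' [mod N ]
    signed-cong false a≡a' = a≡a'
    signed-cong true  a≡a' = neg-cong-mod a≡a'

    ⟨⟩-∙ : ∀ a α b β → ⟨ a , α ⟩ ∙ ⟨ b , β ⟩ ≡ ⟨ signed β a + b , α xor β ⟩
    ⟨⟩-∙ a α b β = ≡-by-exp
      (≡-mod-trans (exp-∙ ⟨ a , α ⟩ ⟨ b , β ⟩)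
        (≡-mod-trans (+-cong-mod (signed-cong β (exp-⟨⟩ a α)) (exp-⟨⟩ b β)) (≡-mod-sym (exp-⟨⟩ _ (α xor β)))))
      (bit-∙ ⟨ a , α ⟩ ⟨ b , β ⟩)

    ⟨⟩-⁻¹ : ∀ a α → ⟨ a , α ⟩ ⁻¹ ≡ ⟨ signed (not α) a , α ⟩
    ⟨⟩-⁻¹ a true  = refl
    ⟨⟩-⁻¹ a false = ≡-by-exp (begin
      + toℕ (red (n ℕ.∸ toℕ i)) ≈⟨ exp-red _ ⟩
      + (n ℕ.∸ toℕ i)           ≡⟨ +[n∸i]≡N-i i ⟩
      N - + toℕ i               ≈⟨ N-a≡-a (+ toℕ i) ⟩
      - + toℕ i                 ≈⟨ neg-cong-mod (exp-⟨⟩ a false) ⟩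
      - a                       ≈⟨ exp-⟨⟩ (- a) false ⟨
      exp ⟨ - a , false ⟩       ∎) refl
      where
      i = proj₁ ⟨ a , false ⟩
      open import Relation.Binary.Reasoning.Setoid (≡-mod-setoid {N})

    ∙-assoc : ∀ g h l → (g ∙ h) ∙ l ≡ g ∙ (h ∙ l)
    ∙-assoc g h l = ⟨⟩-elim (λ g → (g ∙ h) ∙ l ≡ g ∙ (h ∙ l)) (λ a α →
                    ⟨⟩-elim (λ h → (⟨ a , α ⟩ ∙ h) ∙ l ≡ ⟨ a , α ⟩ ∙ (h ∙ l)) (λ b β →
                    ⟨⟩-elim (λ l → (⟨ a , α ⟩ ∙ ⟨ b , β ⟩) ∙ l ≡ ⟨ a , α ⟩ ∙ (⟨ b , β ⟩ ∙ l)) (λ c γ →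
                    assoc⟨⟩ a α b β c γ) l) h) g
      where
      signed-assoc : ∀ β γ a b c → signed γ (signed β a + b) + c ≡ signed (β xor γ) a + (signed γ b + c)
      signed-assoc false false = +-assoc
      signed-assoc false true  = (∀ a b c → - (a + b) + c ≡ - a + (- b + c)) ∋ solve-∀
      signed-assoc true  false = λ a → +-assoc (- a)
      signed-assoc true  true  = (∀ a b c → - (- a + b) + c ≡ a + (- b + c)) ∋ solve-∀
      assoc⟨⟩ : ∀ a α b β c γ → (⟨ a , α ⟩ ∙ ⟨ b , β ⟩) ∙ ⟨ c , γ ⟩ ≡ ⟨ a , α ⟩ ∙ (⟨ b , β ⟩ ∙ ⟨ c , γ ⟩)
      assoc⟨⟩ a α b β c γ = begin
        (⟨ a , α ⟩ ∙ ⟨ b , β ⟩) ∙ ⟨ c , γ ⟩                        ≡⟨ cong (_∙ ⟨ c , γ ⟩) (⟨⟩-∙ a α b β) ⟩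
        ⟨ signed β a + b , α xor β ⟩ ∙ ⟨ c , γ ⟩                    ≡⟨ ⟨⟩-∙ _ _ c γ ⟩
        ⟨ signed γ (signed β a + b) + c , (α xor β) xor γ ⟩         ≡⟨ cong₂ ⟨_,_⟩ (signed-assoc β γ a b c) (xor-assoc α β γ) ⟩
        ⟨ signed (β xor γ) a + (signed γ b + c) , α xor (β xor γ) ⟩ ≡⟨ ⟨⟩-∙ a α _ _ ⟨
        ⟨ a , α ⟩ ∙ ⟨ signed γ b + c , β xor γ ⟩                    ≡⟨ cong (⟨ a , α ⟩ ∙_) (⟨⟩-∙ b β c γ) ⟨
        ⟨ a , α ⟩ ∙ (⟨ b , β ⟩ ∙ ⟨ c , γ ⟩)                        ∎
        where open ≡-Reasoning

    ∙-identityˡ : ∀ g → e ∙ g ≡ g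
    ∙-identityˡ = ⟨⟩-elim (λ g → e ∙ g ≡ g) λ a α → trans (⟨⟩-∙ (+ 0) false a α) (cong (⟨_, α ⟩) (0+a α a))
      where
      0+a : ∀ α a → signed α (+ 0) + a ≡ a
      0+a false = +-identityˡ
      0+a true  = +-identityˡ

    ∙-identityʳ : ∀ g → g ∙ e ≡ g
    ∙-identityʳ = ⟨⟩-elim (λ g → g ∙ e ≡ g) λ a α → trans (⟨⟩-∙ a α (+ 0) false) (cong₂ ⟨_,_⟩ (+-identityʳ a) (xor-identityʳ α))

    ∙-inverseˡ : ∀ g → g ⁻¹ ∙ g ≡ e
    ∙-inverseˡ = ⟨⟩-elim (λ g → g ⁻¹ ∙ g ≡ e) λ a α → begin
      ⟨ a , α ⟩ ⁻¹ ∙ ⟨ a , α ⟩                          ≡⟨ cong (_∙ ⟨ a , α ⟩) (⟨⟩-⁻¹ a α) ⟩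
      ⟨ signed (not α) a , α ⟩ ∙ ⟨ a , α ⟩              ≡⟨ ⟨⟩-∙ _ α a α ⟩
      ⟨ signed α (signed (not α) a) + a , α xor α ⟩     ≡⟨ cong₂ ⟨_,_⟩ (cancel α a) (xor-same α) ⟩
      e                                                 ∎
      where
      open ≡-Reasoning
      cancel : ∀ α a → signed α (signed (not α) a) + a ≡ + 0
      cancel false = +-inverseˡ
      cancel true  = +-inverseˡ

    ∙-inverseʳ : ∀ g → g ∙ g ⁻¹ ≡ e
    ∙-inverseʳ = ⟨⟩-elim (λ g → g ∙ g ⁻¹ ≡ e) λ a α → begin
      ⟨ a , α ⟩ ∙ ⟨ a , α ⟩ ⁻¹                          ≡⟨ cong (⟨ a , α ⟩ ∙_) (⟨⟩-⁻¹ a α) ⟩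
      ⟨ a , α ⟩ ∙ ⟨ signed (not α) a , α ⟩              ≡⟨ ⟨⟩-∙ a α _ α ⟩
      ⟨ signed α a + signed (not α) a , α xor α ⟩       ≡⟨ cong₂ ⟨_,_⟩ (cancel α a) (xor-same α) ⟩
      e                                                 ∎
      where
      open ≡-Reasoning
      cancel : ∀ α a → signed α a + signed (not α) a ≡ + 0
      cancel false = +-inverseʳ
      cancel true  = +-inverseˡ

    ∙-isGroup : IsGroup _≡_ _∙_ e _⁻¹
    ∙-isGroup = record
      { isMonoid = record
        { isSemigroup = record { isMagma = record { isEquivalence = isEquivalence ; ∙-cong = cong₂ _∙_ } ; assoc = ∙-assoc }
        ; identity = ∙-identityˡ , ∙-identityʳ }
      ; inverse = ∙-inverseˡ , ∙-inverseʳ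
      ; ⁻¹-cong = cong _⁻¹ }

    group : Group 0ℓ 0ℓ
    group = record { isGroup = ∙-isGroup }

    open import Algebra.Properties.Group group public
      using (∙-cancelˡ; ⁻¹-involutive; ⁻¹-anti-homo-∙; inverseʳ-unique; y≈x\\z; x≈z//y; \\-leftDividesʳ; //-rightDividesˡ; //-rightDividesʳ)

    x^≡⟨⟩ : ∀ m → x^ m ≡ ⟨ + m , false ⟩
    x^≡⟨⟩ m = ≡-by-exp (≡-mod-trans (exp-red m) (≡-mod-sym (exp-⟨⟩ (+ m) false))) refl

    x^-≡⟨⟩ : ∀ m → x^- m ≡ ⟨ - + m , false ⟩
    x^-≡⟨⟩ m = trans (cong _⁻¹ (x^≡⟨⟩ m)) (⟨⟩-⁻¹ (+ m) false)

    y≡⟨⟩ : y ≡ ⟨ + 0 , true ⟩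
    y≡⟨⟩ = cong (λ g → proj₁ g , true) (x^≡⟨⟩ 0)

    yx^≡⟨⟩ : ∀ m → y ∙ x^ m ≡ ⟨ + m , true ⟩
    yx^≡⟨⟩ m = trans (cong₂ _∙_ y≡⟨⟩ (x^≡⟨⟩ m)) (⟨⟩-∙ (+ 0) true (+ m) false)

    yx^-≡⟨⟩ : ∀ m → y ∙ x^- m ≡ ⟨ - + m , true ⟩
    yx^-≡⟨⟩ m = trans (cong₂ _∙_ y≡⟨⟩ (x^-≡⟨⟩ m)) (trans (⟨⟩-∙ (+ 0) true (- + m) false) (cong ⟨_, true ⟩ (+-identityˡ (- + m))))

    x^-∙-x^ : ∀ a b → x^ a ∙ x^ b ≡ x^ (a ℕ.+ b)
    x^-∙-x^ a b = begin
      x^ a ∙ x^ b                      ≡⟨ cong₂ _∙_ (x^≡⟨⟩ a) (x^≡⟨⟩ b) ⟩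
      ⟨ + a , false ⟩ ∙ ⟨ + b , false ⟩ ≡⟨ ⟨⟩-∙ (+ a) false (+ b) false ⟩
      ⟨ + a + + b , false ⟩            ≡⟨ cong ⟨_, false ⟩ (pos-+ a b) ⟨
      ⟨ + (a ℕ.+ b) , false ⟩          ≡⟨ x^≡⟨⟩ (a ℕ.+ b) ⟨
      x^ (a ℕ.+ b)                     ∎
      where open ≡-Reasoning

    rotation-η : ∀ {g} → bit g ≡ false → x^ (toℕ (proj₁ g)) ≡ g
    rotation-η {g} refl = trans (x^≡⟨⟩ _) (⟨⟩-η g)

    reflection-η : ∀ {g} → bit g ≡ true → y ∙ x^ (toℕ (proj₁ g)) ≡ g
    reflection-η {g} refl = trans (yx^≡⟨⟩ _) (⟨⟩-η g)

    reflection-involutive : ∀ {g} → bit g ≡ true → g ∙ g ≡ e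
    reflection-involutive {g} refl = begin
      g ∙ g                                 ≡⟨ cong₂ _∙_ (⟨⟩-η g) (⟨⟩-η g) ⟨
      ⟨ exp g , true ⟩ ∙ ⟨ exp g , true ⟩   ≡⟨ ⟨⟩-∙ (exp g) true (exp g) true ⟩
      ⟨ - exp g + exp g , false ⟩           ≡⟨ cong ⟨_, false ⟩ (+-inverseˡ (exp g)) ⟩
      e                                     ∎
      where open ≡-Reasoning

    2∣N : + 2 ℤ.∣ N
    2∣N = divides (+ 2 * K) (4K≡2K*2 K)
      where
      4K≡2K*2 : ∀ K → + 4 * K ≡ + 2 * K * + 2
      4K≡2K*2 = solve-∀

    4∣N : + 4 ℤ.∣ N
    4∣N = divides K (*-comm (+ 4) K)

    parity : G → Bool
    parity (i , _) = toℕ i ℕ.% 2 ℕ.≡ᵇ 1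

    parity-spec : ∀ g → exp g ≡ + ⌊ parity g ⌋ [mod + 2 ]
    parity-spec (i , _) = subst (λ r → + toℕ i ≡ + r [mod + 2 ]) (r≡⌊r≡ᵇ1⌋ (m%n<n (toℕ i) 2)) (residue-mod 2 (toℕ i))
      where
      r≡⌊r≡ᵇ1⌋ : ∀ {r} → r ℕ.< 2 → r ≡ ⌊ r ℕ.≡ᵇ 1 ⌋
      r≡⌊r≡ᵇ1⌋ {0} _ = refl
      r≡⌊r≡ᵇ1⌋ {1} _ = refl
      r≡⌊r≡ᵇ1⌋ {ℕ.suc (ℕ.suc _)} (ℕ.s≤s (ℕ.s≤s ()))

    parity-unique : ∀ {g} b → exp g ≡ + ⌊ b ⌋ [mod + 2 ] → parity g ≡ b
    parity-unique {g} b g≡b = ⌊⌋-injective (parity g) b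
      (residue-unique (⌊⌋<2 (parity g)) (⌊⌋<2 b) (≡-mod-trans (≡-mod-sym (parity-spec g)) g≡b))
      where
      ⌊⌋<2 : ∀ b → ⌊ b ⌋ ℕ.< 2
      ⌊⌋<2 false = ℕ.s≤s ℕ.z≤n
      ⌊⌋<2 true  = ℕ.s≤s (ℕ.s≤s ℕ.z≤n)
      ⌊⌋-injective : ∀ a b → ⌊ a ⌋ ≡ ⌊ b ⌋ → a ≡ b
      ⌊⌋-injective false false _ = refl
      ⌊⌋-injective true  true  _ = refl

    parity-∙ : ∀ g h → parity (g ∙ h) ≡ parity g xor parity h
    parity-∙ g h = parity-unique {g ∙ h} (parity g xor parity h) (begin
      exp (g ∙ h)                              ≈⟨ ≡-mod-divisor 2∣N (exp-∙ g h) ⟩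
      signed (bit h) (exp g) + exp h           ≈⟨ +-cong-mod (signed≡mod2 (bit h) (exp g)) (parity-spec h) ⟩
      exp g + + ⌊ parity h ⌋                   ≈⟨ +-cong-mod (parity-spec g) (≡⇒≡-mod {a = + ⌊ parity h ⌋} refl) ⟩
      + ⌊ parity g ⌋ + + ⌊ parity h ⌋          ≈⟨ ⌊⌋-xor (parity g) (parity h) ⟩
      + ⌊ parity g xor parity h ⌋              ∎)
      where
      open import Relation.Binary.Reasoning.Setoid (≡-mod-setoid {+ 2})
      signed≡mod2 : ∀ b a → signed b a ≡ a [mod + 2 ]
      signed≡mod2 false a = ≡⇒≡-mod refl
      signed≡mod2 true  a = ≡-mod-by-quotient (- a) (-a≡a-a*2 a)
        where
        -a≡a-a*2 : ∀ a → - a ≡ a + - a * + 2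
        -a≡a-a*2 = solve-∀
      ⌊⌋-xor : ∀ a b → + ⌊ a ⌋ + + ⌊ b ⌋ ≡ + ⌊ a xor b ⌋ [mod + 2 ]
      ⌊⌋-xor false b     = ≡⇒≡-mod refl
      ⌊⌋-xor true  false = ≡⇒≡-mod refl
      ⌊⌋-xor true  true  = ≡-mod-by-quotient (+ 1) refl

    parity-e : parity e ≡ false
    parity-e = parity-unique {e} false (≡-mod-divisor 2∣N (exp-⟨⟩ (+ 0) false))

    parity-⁻¹ : ∀ g → parity (g ⁻¹) ≡ parity g
    parity-⁻¹ g = xor≡false (parity (g ⁻¹)) (parity g) (trans (sym (parity-∙ (g ⁻¹) g)) (trans (cong parity (∙-inverseˡ g)) parity-e))
      where
      xor≡false : ∀ a b → a xor b ≡ false → a ≡ b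
      xor≡false false false _ = refl
      xor≡false true  true  _ = refl

    allG-enumerates : Enumerates _≟G_ allG
    allG-enumerates = cartesianProduct-enumerates _≟G_ (allFin-enumerates n) bools-enumerate
      where
      bools-enumerate : Enumerates Bool._≟_ (true ∷ false ∷ [])
      bools-enumerate = enumerates λ where
        true  → refl
        false → refl

    pairs : List (G × G)
    pairs = cartesianProduct allG allG

    open import Data.List.Membership.DecPropositional _≟G_ public using (_∈?_)

    _≟²_ : (p q : G × G) → Dec (p ≡ q)
    _≟²_ = ≡-dec _≟G_ _≟G_

    pairs-enumerate : Enumerates _≟²_ pairs
    pairs-enumerate = cartesianProduct-enumerates _≟²_ allG-enumerates allG-enumerates

    count : ∀ {P P' : G → Set} → Decidable P → Decidable P' → G → ℕ
    count P? P'? g = ∑ pairs (λ p → 𝟙 ((P? (proj₁ p) ×-dec P'? (proj₂ p)) ×-dec (proj₁ p ∙ proj₂ p ≟G g)))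

    coeff≡count : ∀ (R : G → G → Set) (R? : Relation.Binary.Decidable R) r s g → coeff R R? r s g ≡ count (R? r) (R? s) g
    coeff≡count R R? r s g = length-filter _ pairs

  module Signature (k : ℕ) .{{_ : NonZero k}} where

    open DihedralGroup k

    module D₈ = DihedralGroup 1

    π : G → D₈.G
    π g = D₈.⟨ exp g , bit g ⟩

    π-⟨⟩ : ∀ a α → π ⟨ a , α ⟩ ≡ D₈.⟨ a , α ⟩
    π-⟨⟩ a α = D₈.⟨⟩-cong α (≡-mod-divisor 4∣N (exp-⟨⟩ a α))

    π-∙ : ∀ g h → π (g ∙ h) ≡ π g D₈.∙ π h
    π-∙ g h = ⟨⟩-elim (λ g → π (g ∙ h) ≡ π g D₈.∙ π h) (λ a α →
              ⟨⟩-elim (λ h → π (⟨ a , α ⟩ ∙ h) ≡ π ⟨ a , α ⟩ D₈.∙ π h) (λ b β → begin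
                π (⟨ a , α ⟩ ∙ ⟨ b , β ⟩)              ≡⟨ cong π (⟨⟩-∙ a α b β) ⟩
                π ⟨ signed β a + b , α xor β ⟩          ≡⟨ π-⟨⟩ (signed β a + b) (α xor β) ⟩
                D₈.⟨ signed β a + b , α xor β ⟩         ≡⟨ D₈.⟨⟩-∙ a α b β ⟨
                D₈.⟨ a , α ⟩ D₈.∙ D₈.⟨ b , β ⟩          ≡⟨ cong₂ D₈._∙_ (π-⟨⟩ a α) (π-⟨⟩ b β) ⟨
                π ⟨ a , α ⟩ D₈.∙ π ⟨ b , β ⟩            ∎) h) g
      where open ≡-Reasoning

    parity-π : ∀ g → parity g ≡ D₈.parity (π g)
    parity-π g = parity-unique {g} (D₈.parity (π g))
      (≡-mod-trans (≡-mod-divisor 2∣4 (≡-mod-sym (D₈.exp-⟨⟩ (exp g) (bit g)))) (D₈.parity-spec (π g)))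
      where
      2∣4 : + 2 ℤ.∣ + 4 * + 1
      2∣4 = divides (+ 2) refl

module SRings where

  open import Data.Nat as ℕ using (ℕ; NonZero; _*_; _<_; _≤_)
  import Data.Nat.Properties as ℕ
  open import Data.Nat.Tactic.RingSolver using (solve-∀)
  open import Data.List using (List; []; _∷_)
  open import Data.Product using (∃₂; _×_; _,_; proj₁; proj₂)
  open import Function using (_∘_)
  open import Relation.Nullary using (Dec; yes; no; ¬_; contradiction)
  open import Relation.Nullary.Decidable using (_×-dec_; map′)
  open import Relation.Unary using (Decidable)
  open import Relation.Binary using (IsEquivalence)
  open import Relation.Binary.PropositionalEquality hiding (isEquivalence)
  open FiniteSums
  open DihedralArithmetic

  module _ (k : ℕ) .{{_ : NonZero k}} where

    open DihedralGroup k

    isSRing-resp-⇔ : ∀ {R R' : G → G → Set} → (∀ {g h} → R g h → R' g h) → (∀ {g h} → R' g h → R g h) →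
                     IsSRing R → IsSRing R'
    isSRing-resp-⇔ {R} {R'} to from R-isSRing = record
      { isEquivalence = record
        { refl  = to R-refl
        ; sym   = λ g~h → to (R-sym (from g~h))
        ; trans = λ g~h h~l → to (R-trans (from g~h) (from h~l)) }
      ; R?         = R'?
      ; unit-basic = λ g e~g → unit-basic g (from e~g)
      ; inv-closed = λ g h g~h → to (inv-closed g h (from g~h))
      ; mul-closed = λ r s g h g~h → trans (coeff≡count R' R'? r s g)
                       (trans (sym (coeff≡count R R? r s g)) (trans (mul-closed r s g h (from g~h))
                       (trans (coeff≡count R R? r s h) (sym (coeff≡count R' R'? r s h)))))
      }
      where
      R'? : ∀ g h → Dec (R' g h)
      R'? g h = map′ to from (IsSRing.R? R-isSRing g h)
      open IsSRing R-isSRing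
      open IsEquivalence isEquivalence renaming (refl to R-refl; sym to R-sym; trans to R-trans)

  module SRingProperties (k : ℕ) .{{_ : NonZero k}} {Q : Dihedral.G k → Dihedral.G k → Set}
                     (Q-isSRing : Dihedral.IsSRing k Q) where

    open DihedralGroup k
    open IsSRing Q-isSRing renaming (R? to Q?)
    open IsEquivalence isEquivalence renaming (refl to Q-refl; sym to Q-sym; trans to Q-trans)

    private variable
      P P' : G → Set

    infixl 7 _∙ˢ_
    _∙ˢ_ : (G → Set) → (G → Set) → G → Set
    (P ∙ˢ P') g = ∃₂ λ a b → P a × P' b × a ∙ b ≡ g

    ∙ˢ-union : UnionOfBasic Q P → UnionOfBasic Q P' → UnionOfBasic Q (P ∙ˢ P')
    ∙ˢ-union P-union P'-union g h g~h (a , b , Pa , P'b , ab≡g) =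
      a' , b' , P-union a a' a~a' Pa , P'-union b b' b~b' P'b , a'b'≡h
      where
      factors : G → G × G → ℕ
      factors x p = 𝟙 ((Q? a (proj₁ p) ×-dec Q? b (proj₂ p)) ×-dec (proj₁ p ∙ proj₂ p ≟G x))
      1≤coeff[g] : 1 ≤ coeff Q Q? a b g
      1≤coeff[g] = subst₂ _≤_ (𝟙-yes ((Q? a a ×-dec Q? b b) ×-dec (a ∙ b ≟G g)) ((Q-refl , Q-refl) , ab≡g))
                     (sym (coeff≡count Q Q? a b g)) (≤-∑ pairs-enumerate (a , b) (factors g))
      0<coeff[h] : 0 < count (Q? a) (Q? b) h
      0<coeff[h] = subst (0 <_) (trans (mul-closed a b g h g~h) (coeff≡count Q Q? a b h)) 1≤coeff[g]
      witness = ∑-pos pairs (factors h) 0<coeff[h]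
      a' = proj₁ (proj₁ witness)
      b' = proj₂ (proj₁ witness)
      factorisation : (Q a a' × Q b b') × a' ∙ b' ≡ h
      factorisation = 𝟙-pos ((Q? a a' ×-dec Q? b b') ×-dec (a' ∙ b' ≟G h)) (proj₂ witness)
      a~a' = proj₁ (proj₁ factorisation)
      b~b' = proj₂ (proj₁ factorisation)
      a'b'≡h = proj₂ factorisation

    union-class : ∀ c → UnionOfBasic Q (Q c)
    union-class c g h g~h c~g = Q-trans c~g g~h

    union-× : UnionOfBasic Q P → UnionOfBasic Q P' → UnionOfBasic Q (λ g → P g × P' g)
    union-× P-union P'-union g h g~h (Pg , P'g) = P-union g h g~h Pg , P'-union g h g~h P'g

    union-¬ : UnionOfBasic Q P → UnionOfBasic Q (λ g → ¬ P g)
    union-¬ P-union g h g~h ¬Pg Ph = ¬Pg (P-union h g (Q-sym g~h) Ph)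

    Thin : G → Set
    Thin u = ∀ h → Q u h → h ≡ u

    union-≡ : ∀ {u} → Thin u → UnionOfBasic Q (_≡ u)
    union-≡ u-thin g h g~h refl = u-thin h g~h

    union-≢ : ∀ {u} → Thin u → UnionOfBasic Q (_≢ u)
    union-≢ u-thin = union-¬ (union-≡ u-thin)

    thin-e : Thin e
    thin-e = unit-basic

    thin-∙ : ∀ {u v} → Thin u → Thin v → Thin (u ∙ v)
    thin-∙ {u} {v} u-thin v-thin h uv~h = trans (sym ab≡h) (cong₂ _∙_ a≡u b≡v)
      where
      factorisation = ∙ˢ-union (union-≡ u-thin) (union-≡ v-thin) (u ∙ v) h uv~h (u , v , refl , refl , refl)
      a≡u = proj₁ (proj₂ (proj₂ factorisation))
      b≡v = proj₁ (proj₂ (proj₂ (proj₂ factorisation)))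
      ab≡h = proj₂ (proj₂ (proj₂ (proj₂ factorisation)))
    thin-⁻¹ : ∀ {u} → Thin u → Thin (u ⁻¹)
    thin-⁻¹ {u} u-thin h u⁻¹~h = begin
      h            ≡⟨ ⁻¹-involutive h ⟨
      (h ⁻¹) ⁻¹    ≡⟨ cong _⁻¹ (u-thin (h ⁻¹) (subst (λ v → Q v (h ⁻¹)) (⁻¹-involutive u) (inv-closed _ _ u⁻¹~h))) ⟩
      u ⁻¹         ∎
      where open ≡-Reasoning

    thin-translateˡ : ∀ {u} → Thin u → ∀ {g h} → Q g h → Q (u ∙ g) (u ∙ h)
    thin-translateˡ {u} u-thin {g} {h} g~h = subst (Q (u ∙ g)) b≡uh ug~b
      where
      factorisation = ∙ˢ-union (union-≡ (thin-⁻¹ u-thin)) (union-class (u ∙ g)) g h g~h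
                        (u ⁻¹ , u ∙ g , refl , Q-refl , \\-leftDividesʳ u g)
      a = proj₁ factorisation
      b = proj₁ (proj₂ factorisation)
      a≡u⁻¹ : a ≡ u ⁻¹
      a≡u⁻¹ = proj₁ (proj₂ (proj₂ factorisation))
      ug~b : Q (u ∙ g) b
      ug~b = proj₁ (proj₂ (proj₂ (proj₂ factorisation)))
      b≡uh : b ≡ u ∙ h
      b≡uh = trans (y≈x\\z a b h (proj₂ (proj₂ (proj₂ (proj₂ factorisation))))) (cong (_∙ h) (trans (cong _⁻¹ a≡u⁻¹) (⁻¹-involutive u)))

    thin-translateʳ : ∀ {u} → Thin u → ∀ {g h} → Q g h → Q (g ∙ u) (h ∙ u)
    thin-translateʳ {u} u-thin {g} {h} g~h = subst (Q (g ∙ u)) a≡hu gu~a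
      where
      factorisation = ∙ˢ-union (union-class (g ∙ u)) (union-≡ (thin-⁻¹ u-thin)) g h g~h
                        (g ∙ u , u ⁻¹ , Q-refl , refl , //-rightDividesʳ u g)
      a = proj₁ factorisation
      b = proj₁ (proj₂ factorisation)
      gu~a : Q (g ∙ u) a
      gu~a = proj₁ (proj₂ (proj₂ factorisation))
      b≡u⁻¹ : b ≡ u ⁻¹
      b≡u⁻¹ = proj₁ (proj₂ (proj₂ (proj₂ factorisation)))
      a≡hu : a ≡ h ∙ u
      a≡hu = trans (x≈z//y a b h (proj₂ (proj₂ (proj₂ (proj₂ factorisation))))) (cong (h ∙_) (trans (cong _⁻¹ b≡u⁻¹) (⁻¹-involutive u)))

    union-translateˡ : ∀ {u} → Thin u → UnionOfBasic Q P → UnionOfBasic Q (λ g → P (u ∙ g))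
    union-translateˡ u-thin P-union g h g~h = P-union _ _ (thin-translateˡ u-thin g~h)

    union-translateʳ : ∀ {u} → Thin u → UnionOfBasic Q P → UnionOfBasic Q (λ g → P (g ∙ u))
    union-translateʳ u-thin P-union g h g~h = P-union _ _ (thin-translateʳ u-thin g~h)

    private
      first-in-class : List G → G → G
      first-in-class []       a = e
      first-in-class (x ∷ xs) a with Q? a x
      ... | yes _ = x
      ... | no  _ = first-in-class xs a

      first-in-class-∈ : ∀ xs a → 0 < ∑ xs (𝟙 ∘ Q? a) → Q a (first-in-class xs a)
      first-in-class-∈ (x ∷ xs) a 0<∑ with Q? a x
      ... | yes a~x = a~x
      ... | no  _   = first-in-class-∈ xs a 0<∑

      first-in-class-cong : ∀ xs {a b} → Q a b → first-in-class xs a ≡ first-in-class xs b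
      first-in-class-cong []       a~b = refl
      first-in-class-cong (x ∷ xs) {a} {b} a~b with Q? a x | Q? b x
      ... | yes _   | yes _   = refl
      ... | no  _   | no  _   = first-in-class-cong xs a~b
      ... | yes a~x | no b≁x  = contradiction (Q-trans (Q-sym a~b) a~x) b≁x
      ... | no a≁x  | yes b~x = contradiction (Q-trans a~b b~x) a≁x

    representative : G → G
    representative = first-in-class allG

    representative-∈ : ∀ a → Q a (representative a)
    representative-∈ a = first-in-class-∈ allG a
      (subst (_≤ ∑ allG (𝟙 ∘ Q? a)) (𝟙-yes (Q? a a) Q-refl) (≤-∑ allG-enumerates a (𝟙 ∘ Q? a)))

    representative-cong : ∀ {a b} → Q a b → representative a ≡ representative b
    representative-cong = first-in-class-cong allG

    module _ {P : G → Set} (P? : Decidable P) (P-union : UnionOfBasic Q P) where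

      weight : G → ℕ
      weight r = 𝟙 ((representative r ≟G r) ×-dec P? r)

      𝟙-union : ∀ a → 𝟙 (P? a) ≡ ∑ allG (λ r → weight r * 𝟙 (Q? r a))
      𝟙-union a = sym (trans (∑-cong allG only-representative) (∑-select allG-enumerates (representative a) (λ _ → 𝟙 (P? a))))
        where
        only-representative : ∀ r → weight r * 𝟙 (Q? r a) ≡ 𝟙 (representative a ≟G r) * 𝟙 (P? a)
        only-representative r = begin
          weight r * 𝟙 (Q? r a)                                          ≡⟨ 𝟙-× ((representative r ≟G r) ×-dec P? r) (Q? r a) ⟨
          𝟙 (((representative r ≟G r) ×-dec P? r) ×-dec Q? r a)
            ≡⟨ 𝟙-cong (((representative r ≟G r) ×-dec P? r) ×-dec Q? r a) ((representative a ≟G r) ×-dec P? a) to from ⟩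
          𝟙 ((representative a ≟G r) ×-dec P? a)                        ≡⟨ 𝟙-× (representative a ≟G r) (P? a) ⟩
          𝟙 (representative a ≟G r) * 𝟙 (P? a)                          ∎
          where
          open ≡-Reasoning
          to : ((representative r ≡ r) × P r) × Q r a → (representative a ≡ r) × P a
          to ((rep≡r , Pr) , r~a) = trans (sym (representative-cong r~a)) rep≡r , P-union r a r~a Pr
          from : (representative a ≡ r) × P a → ((representative r ≡ r) × P r) × Q r a
          from (refl , Pa) = (sym (representative-cong (representative-∈ a)) , P-union a _ (representative-∈ a) Pa) , Q-sym (representative-∈ a)

    count-as-∑∑ : ∀ {P P'} (P? : Decidable P) (P'? : Decidable P') g →
      count P? P'? g ≡ ∑ allG (λ a → ∑ allG (λ b → 𝟙 (P? a) * 𝟙 (P'? b) * 𝟙 (a ∙ b ≟G g)))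
    count-as-∑∑ P? P'? g = trans (∑-cartesianProduct allG allG _) (∑-cong allG λ a → ∑-cong allG λ b →
      trans (𝟙-× (P? a ×-dec P'? b) (a ∙ b ≟G g)) (cong (_* 𝟙 (a ∙ b ≟G g)) (𝟙-× (P? a) (P'? b))))

    module _ {P P' : G → Set} (P? : Decidable P) (P'? : Decidable P')
             (P-union : UnionOfBasic Q P) (P'-union : UnionOfBasic Q P') where

      private
        w = weight P? P-union
        w' = weight P'? P'-union

      count≡∑coeff : ∀ g → count P? P'? g ≡ ∑ allG (λ r → ∑ allG (λ s → w r * w' s * coeff Q Q? r s g))
      count≡∑coeff g = begin
        count P? P'? g
          ≡⟨ count-as-∑∑ P? P'? g ⟩
        ∑ allG (λ a → ∑ allG (λ b → 𝟙 (P? a) * 𝟙 (P'? b) * E a b))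
          ≡⟨ ∑-cong allG (λ a → ∑-cong allG (λ b → expand a b)) ⟩
        ∑ allG (λ a → ∑ allG (λ b → ∑ allG (λ r → ∑ allG (λ s → w r * w' s * (q r a * q s b * E a b)))))
          ≡⟨ ∑-cong allG (λ a → ∑-swap allG allG _) ⟩
        ∑ allG (λ a → ∑ allG (λ r → ∑ allG (λ b → ∑ allG (λ s → w r * w' s * (q r a * q s b * E a b)))))
          ≡⟨ ∑-swap allG allG _ ⟩
        ∑ allG (λ r → ∑ allG (λ a → ∑ allG (λ b → ∑ allG (λ s → w r * w' s * (q r a * q s b * E a b)))))
          ≡⟨ ∑-cong allG (λ r → ∑-cong allG (λ a → ∑-swap allG allG _)) ⟩
        ∑ allG (λ r → ∑ allG (λ a → ∑ allG (λ s → ∑ allG (λ b → w r * w' s * (q r a * q s b * E a b)))))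
          ≡⟨ ∑-cong allG (λ r → ∑-swap allG allG _) ⟩
        ∑ allG (λ r → ∑ allG (λ s → ∑ allG (λ a → ∑ allG (λ b → w r * w' s * (q r a * q s b * E a b)))))
          ≡⟨ ∑-cong allG (λ r → ∑-cong allG (λ s → factor-out r s)) ⟩
        ∑ allG (λ r → ∑ allG (λ s → w r * w' s * coeff Q Q? r s g))
          ∎
        where
        open ≡-Reasoning
        q : G → G → ℕ
        q r a = 𝟙 (Q? r a)
        E : G → G → ℕ
        E a b = 𝟙 (a ∙ b ≟G g)
        distribute : ∀ (x y u v e : ℕ) → x * u * (y * v * e) ≡ x * y * (u * v * e)
        distribute = solve-∀
        expand : ∀ a b → 𝟙 (P? a) * 𝟙 (P'? b) * E a b ≡ ∑ allG (λ r → ∑ allG (λ s → w r * w' s * (q r a * q s b * E a b)))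
        expand a b = begin
          𝟙 (P? a) * 𝟙 (P'? b) * E a b
            ≡⟨ cong₂ (λ u v → u * v * E a b) (𝟙-union P? P-union a) (𝟙-union P'? P'-union b) ⟩
          ∑ allG (λ r → w r * q r a) * ∑ allG (λ s → w' s * q s b) * E a b
            ≡⟨ ℕ.*-assoc (∑ allG (λ r → w r * q r a)) _ (E a b) ⟩
          ∑ allG (λ r → w r * q r a) * (∑ allG (λ s → w' s * q s b) * E a b)
            ≡⟨ ∑-*ʳ allG _ (λ r → w r * q r a) ⟨
          ∑ allG (λ r → w r * q r a * (∑ allG (λ s → w' s * q s b) * E a b))
            ≡⟨ ∑-cong allG (λ r → cong (w r * q r a *_) (∑-*ʳ allG (E a b) (λ s → w' s * q s b))) ⟨
          ∑ allG (λ r → w r * q r a * ∑ allG (λ s → w' s * q s b * E a b))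
            ≡⟨ ∑-cong allG (λ r → ∑-*ˡ allG (w r * q r a) (λ s → w' s * q s b * E a b)) ⟨
          ∑ allG (λ r → ∑ allG (λ s → w r * q r a * (w' s * q s b * E a b)))
            ≡⟨ ∑-cong allG (λ r → ∑-cong allG (λ s → distribute (w r) (w' s) (q r a) (q s b) (E a b))) ⟩
          ∑ allG (λ r → ∑ allG (λ s → w r * w' s * (q r a * q s b * E a b)))
            ∎
        factor-out : ∀ r s → ∑ allG (λ a → ∑ allG (λ b → w r * w' s * (q r a * q s b * E a b))) ≡ w r * w' s * coeff Q Q? r s g
        factor-out r s = begin
          ∑ allG (λ a → ∑ allG (λ b → w r * w' s * (q r a * q s b * E a b)))
            ≡⟨ ∑-cong allG (λ a → ∑-*ˡ allG (w r * w' s) _) ⟩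
          ∑ allG (λ a → w r * w' s * ∑ allG (λ b → q r a * q s b * E a b))
            ≡⟨ ∑-*ˡ allG (w r * w' s) _ ⟩
          w r * w' s * ∑ allG (λ a → ∑ allG (λ b → q r a * q s b * E a b))
            ≡⟨ cong (w r * w' s *_) (count-as-∑∑ (Q? r) (Q? s) g) ⟨
          w r * w' s * count (Q? r) (Q? s) g
            ≡⟨ cong (w r * w' s *_) (coeff≡count Q Q? r s g) ⟨
          w r * w' s * coeff Q Q? r s g
            ∎

      count-invariant : ∀ {g h} → Q g h → count P? P'? g ≡ count P? P'? h
      count-invariant {g} {h} g~h = begin
        count P? P'? g                                               ≡⟨ count≡∑coeff g ⟩
        ∑ allG (λ r → ∑ allG (λ s → w r * w' s * coeff Q Q? r s g))
          ≡⟨ ∑-cong allG (λ r → ∑-cong allG (λ s → cong (w r * w' s *_) (mul-closed r s g h g~h))) ⟩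
        ∑ allG (λ r → ∑ allG (λ s → w r * w' s * coeff Q Q? r s h))  ≡⟨ count≡∑coeff h ⟨
        count P? P'? h                                               ∎
        where open ≡-Reasoning

module Proof (k : ℕ) .{{_ : NonZero k}} (k≥3 : 3 ≤ k) (k-odd : ¬ 2 ∣ k) where

  open import Data.Nat as ℕ using (ℕ; NonZero; _≤_; _<_; z≤n; s≤s)
  import Data.Nat.Properties as ℕ
  open import Data.Nat.DivMod using (m≡m%n+[m/n]*n; m%n<n)
  open import Data.Nat.Divisibility using (m%n≡0⇒n∣m)
  open import Data.Integer using (ℤ; +_; _+_; _*_; -_; _-_)
  open import Data.Integer.Properties using (pos-+; pos-*; *-comm; +-comm; +-identityˡ; m-n≡m⊖n; ⊖-≥)
  open import Data.Integer.Tactic.RingSolver using (solve-∀)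
  open import Data.Bool using (Bool; true; false; _xor_)
  open import Data.Bool.Properties using (xor-identityʳ)
  import Data.Bool.Properties as Bool
  open import Data.Fin using (toℕ)
  open import Data.Product using (∃; ∃₂; _×_; _,_; proj₁; proj₂)
  open import Function using (_∘_)
  open import Data.Sum using (_⊎_; inj₁; inj₂)
  open import Data.List using (List; []; _∷_; filter; cartesianProduct)
  open import Data.List.Relation.Unary.Any using (here; there)
  open import Data.List.Membership.Propositional using (_∈_; _∉_)
  open import Data.List.Membership.Propositional.Properties using (∈-filter⁺; ∈-cartesianProduct⁺)
  open import Relation.Nullary.Decidable using (False; toWitnessFalse; map′; _×-dec_; _⊎-dec_; ¬?)
  open import Relation.Unary using (Decidable)
  open import Relation.Nullary using (Dec; yes; no; ¬_; contradiction)
  open import Relation.Binary.PropositionalEquality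
  open FiniteSums
  open IntegerCongruence
  open DihedralArithmetic
  open SRings

  open DihedralGroup k public
  open Signature k public

  C : ℤ
  C = + (k ℕ./ 2)

  K≡1+2C : K ≡ + 1 + + 2 * C
  K≡1+2C = begin
    + k                                   ≡⟨ cong +_ (m≡m%n+[m/n]*n k 2) ⟩
    + (k ℕ.% 2 ℕ.+ k ℕ./ 2 ℕ.* 2)         ≡⟨ cong (λ r → + (r ℕ.+ k ℕ./ 2 ℕ.* 2)) k%2≡1 ⟩
    + (1 ℕ.+ k ℕ./ 2 ℕ.* 2)               ≡⟨ pos-+ 1 (k ℕ./ 2 ℕ.* 2) ⟩
    + 1 + + (k ℕ./ 2 ℕ.* 2)               ≡⟨ cong (λ v → + 1 + v) (trans (pos-* (k ℕ./ 2) 2) (*-comm C (+ 2))) ⟩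
    + 1 + + 2 * C                         ∎
    where
    open ≡-Reasoning
    k%2≡1 : k ℕ.% 2 ≡ 1
    k%2≡1 with k ℕ.% 2 in eq | m%n<n k 2
    ... | 0 | _ = contradiction (m%n≡0⇒n∣m k 2 eq) k-odd
    ... | 1 | _ = refl
    ... | ℕ.suc (ℕ.suc _) | s≤s (s≤s ())

  z t s₁ s₂ w₀ x : G
  z  = ⟨ + 2 * K , false ⟩
  t  = ⟨ - + 2 , true ⟩
  s₁ = ⟨ + 2 * K - + 1 , true ⟩
  s₂ = ⟨ - + 1 , true ⟩
  w₀ = ⟨ + 2 * K - + 2 , true ⟩
  x  = ⟨ + 1 , false ⟩

  private
    ⟨⟩-∙-≡ : ∀ a α b β c → signed β a + b ≡ c [mod N ] → ⟨ a , α ⟩ ∙ ⟨ b , β ⟩ ≡ ⟨ c , α xor β ⟩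
    ⟨⟩-∙-≡ a α b β c ab≡c = trans (⟨⟩-∙ a α b β) (⟨⟩-cong (α xor β) ab≡c)

  z∙z≡e : z ∙ z ≡ e
  z∙z≡e = ⟨⟩-∙-≡ (+ 2 * K) false (+ 2 * K) false (+ 0) (≡-mod-by-quotient (+ 1) (4K≡N K))
    where
    4K≡N : ∀ K → + 2 * K + + 2 * K ≡ + 0 + + 1 * (+ 4 * K)
    4K≡N = solve-∀

  z-central : ∀ g → z ∙ g ≡ g ∙ z
  z-central = ⟨⟩-elim (λ g → z ∙ g ≡ g ∙ z) central⟨⟩
    where
    shift-by-N : ∀ K a → - (+ 2 * K) + a ≡ a + + 2 * K + - + 1 * (+ 4 * K)
    shift-by-N = solve-∀
    central⟨⟩ : ∀ a α → z ∙ ⟨ a , α ⟩ ≡ ⟨ a , α ⟩ ∙ z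
    central⟨⟩ a false = trans (⟨⟩-∙ (+ 2 * K) false a false) (sym (trans (⟨⟩-∙ a false (+ 2 * K) false) (cong ⟨_, false ⟩ (+-comm a (+ 2 * K)))))
    central⟨⟩ a true  = trans (⟨⟩-∙-≡ (+ 2 * K) false a true (a + + 2 * K) (≡-mod-by-quotient (- + 1) (shift-by-N K a))) (sym (⟨⟩-∙ a true (+ 2 * K) false))

  ∙z-involutive : ∀ g → (g ∙ z) ∙ z ≡ g
  ∙z-involutive g = trans (∙-assoc g z z) (trans (cong (g ∙_) z∙z≡e) (∙-identityʳ g))

  s₁∙z≡s₂ : s₁ ∙ z ≡ s₂
  s₁∙z≡s₂ = ⟨⟩-∙-≡ (+ 2 * K - + 1) true (+ 2 * K) false (- + 1) (≡-mod-by-quotient (+ 1) (eq K))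
    where
    eq : ∀ K → + 2 * K - + 1 + + 2 * K ≡ - + 1 + + 1 * (+ 4 * K)
    eq = solve-∀

  s₁∙s₂≡z : s₁ ∙ s₂ ≡ z
  s₁∙s₂≡z = ⟨⟩-∙-≡ (+ 2 * K - + 1) true (- + 1) true (+ 2 * K) (≡-mod-by-quotient (- + 1) (eq K))
    where
    eq : ∀ K → - (+ 2 * K - + 1) + - + 1 ≡ + 2 * K + - + 1 * (+ 4 * K)
    eq = solve-∀

  s₂∙s₁≡z : s₂ ∙ s₁ ≡ z
  s₂∙s₁≡z = ⟨⟩-∙-≡ (- + 1) true (+ 2 * K - + 1) true (+ 2 * K) (≡⇒≡-mod (eq K))
    where
    eq : ∀ K → - - + 1 + (+ 2 * K - + 1) ≡ + 2 * K
    eq = solve-∀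

  t∙z≡w₀ : t ∙ z ≡ w₀
  t∙z≡w₀ = ⟨⟩-∙-≡ (- + 2) true (+ 2 * K) false (+ 2 * K - + 2) (≡⇒≡-mod (eq K))
    where
    eq : ∀ K → - + 2 + + 2 * K ≡ + 2 * K - + 2
    eq = solve-∀

  t∙t≡e : t ∙ t ≡ e
  t∙t≡e = reflection-involutive {t} refl

  t∙w₀≡z : t ∙ w₀ ≡ z
  t∙w₀≡z = begin
    t ∙ w₀        ≡⟨ cong (t ∙_) t∙z≡w₀ ⟨
    t ∙ (t ∙ z)   ≡⟨ ∙-assoc t t z ⟨
    (t ∙ t) ∙ z   ≡⟨ cong (_∙ z) t∙t≡e ⟩
    e ∙ z         ≡⟨ ∙-identityˡ z ⟩
    z             ∎
    where open ≡-Reasoning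

  t∙z∙t≡z : (t ∙ z) ∙ t ≡ z
  t∙z∙t≡z = begin
    (t ∙ z) ∙ t   ≡⟨ cong (_∙ t) (z-central t) ⟨
    (z ∙ t) ∙ t   ≡⟨ ∙-assoc z t t ⟩
    z ∙ (t ∙ t)   ≡⟨ cong (z ∙_) t∙t≡e ⟩
    z ∙ e         ≡⟨ ∙-identityʳ z ⟩
    z             ∎
    where open ≡-Reasoning

  t∙z∙s₁≡x : (t ∙ z) ∙ s₁ ≡ x
  t∙z∙s₁≡x = trans (cong (_∙ s₁) t∙z≡w₀) (⟨⟩-∙-≡ (+ 2 * K - + 2) true (+ 2 * K - + 1) true (+ 1) (≡⇒≡-mod (eq K)))
    where
    eq : ∀ K → - (+ 2 * K - + 2) + (+ 2 * K - + 1) ≡ + 1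
    eq = solve-∀

  t∙z∙s₂≡x∙z : (t ∙ z) ∙ s₂ ≡ x ∙ z
  t∙z∙s₂≡x∙z = begin
    (t ∙ z) ∙ s₂         ≡⟨ cong ((t ∙ z) ∙_) s₁∙z≡s₂ ⟨
    (t ∙ z) ∙ (s₁ ∙ z)   ≡⟨ ∙-assoc (t ∙ z) s₁ z ⟨
    ((t ∙ z) ∙ s₁) ∙ z   ≡⟨ cong (_∙ z) t∙z∙s₁≡x ⟩
    x ∙ z                ∎
    where open ≡-Reasoning

  x^2k≡z : x^ (2 ℕ.* k) ≡ z
  x^2k≡z = trans (x^≡⟨⟩ (2 ℕ.* k)) (cong ⟨_, false ⟩ (pos-* 2 k))

  yx^2k-1≡s₁ : y ∙ x^ (2 ℕ.* k ℕ.∸ 1) ≡ s₁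
  yx^2k-1≡s₁ = trans (yx^≡⟨⟩ _) (cong ⟨_, true ⟩ (trans (sym (⊖-≥ 1≤2k)) (trans (sym (m-n≡m⊖n (2 ℕ.* k) 1)) (cong (_- + 1) (pos-* 2 k)))))
    where
    1≤2k : 1 ≤ 2 ℕ.* k
    1≤2k = ℕ.≤-trans (s≤s z≤n) (ℕ.≤-trans k≥3 (ℕ.m≤n*m k 2))

  yx^2[k-1]≡w₀ : y ∙ x^ (2 ℕ.* (k ℕ.∸ 1)) ≡ w₀
  yx^2[k-1]≡w₀ = trans (yx^≡⟨⟩ _) (cong ⟨_, true ⟩ (begin
    + (2 ℕ.* (k ℕ.∸ 1))   ≡⟨ pos-* 2 (k ℕ.∸ 1) ⟩
    + 2 * + (k ℕ.∸ 1)     ≡⟨ cong (+ 2 *_) (trans (sym (⊖-≥ 1≤k)) (sym (m-n≡m⊖n k 1))) ⟩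
    + 2 * (K - + 1)       ≡⟨ distrib K ⟩
    + 2 * K - + 2         ∎))
    where
    open ≡-Reasoning
    1≤k : 1 ≤ k
    1≤k = ℕ.≤-trans (s≤s z≤n) k≥3
    distrib : ∀ K → + 2 * (K - + 1) ≡ + 2 * K - + 2
    distrib = solve-∀

  private
    ⟨⟩-apart : ∀ {m} a b α → 0 < m → m < n → b ≡ a + + m → ⟨ a , α ⟩ ≢ ⟨ b , α ⟩
    ⟨⟩-apart {m} a b α 0<m m<n b≡a+m a≡b = ≢0-mod-N 0<m m<n (begin
      + m         ≡⟨ m≡[a+m]-a a (+ m) ⟩
      a + + m - a ≡⟨ cong (_- a) b≡a+m ⟨
      b - a       ≈⟨ +-cong-mod (≡-mod-sym (⟨⟩-injective {a} {α} {b} {α} a≡b)) (≡⇒≡-mod {a = - a} refl) ⟩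
      a - a       ≡⟨ a-a≡0 a ⟩
      + 0         ∎)
      where
      open import Relation.Binary.Reasoning.Setoid (≡-mod-setoid {N})
      m≡[a+m]-a : ∀ a m → m ≡ a + m - a
      m≡[a+m]-a = solve-∀
      a-a≡0 : ∀ a → a - a ≡ + 0
      a-a≡0 = solve-∀

    6≤2k : 6 ≤ 2 ℕ.* k
    6≤2k = ℕ.*-monoʳ-≤ 2 k≥3

    2k≤n : 2 ℕ.* k ≤ n
    2k≤n = ℕ.≤-trans (ℕ.m≤m+n (2 ℕ.* k) (2 ℕ.* k)) (ℕ.≤-reflexive (sym (ℕ.*-distribʳ-+ k 2 2)))

    apart-by-2K+2 : ∀ a b α → b ≡ a + (+ 2 * K + + 2) → ⟨ a , α ⟩ ≢ ⟨ b , α ⟩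
    apart-by-2K+2 a b α b≡ = ⟨⟩-apart a b α (s≤s z≤n) 2+2k<n (trans b≡ (cong (_+_ a) (begin
      + 2 * K + + 2             ≡⟨ cong (_+ + 2) (pos-* 2 k) ⟨
      + (2 ℕ.* k) + + 2         ≡⟨ pos-+ (2 ℕ.* k) 2 ⟨
      + (2 ℕ.* k ℕ.+ 2)         ≡⟨ cong +_ (ℕ.+-comm (2 ℕ.* k) 2) ⟩
      + (2 ℕ.+ 2 ℕ.* k)         ∎)))
      where
      open ≡-Reasoning
      2+2k<n : 2 ℕ.+ 2 ℕ.* k < n
      2+2k<n = ℕ.≤-trans (ℕ.+-monoˡ-≤ (2 ℕ.* k) (ℕ.≤-trans (s≤s (s≤s (s≤s z≤n))) 6≤2k)) (ℕ.≤-reflexive (sym (ℕ.*-distribʳ-+ k 2 2)))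

    apart-by-2K-2 : ∀ a b α → b ≡ a + (+ 2 * K - + 2) → ⟨ a , α ⟩ ≢ ⟨ b , α ⟩
    apart-by-2K-2 a b α b≡ = ⟨⟩-apart a b α 0<2k-2 (ℕ.≤-<-trans (ℕ.m∸n≤m (2 ℕ.* k) 2) 2k<n)
      (trans b≡ (cong (_+_ a) (trans (cong (_- + 2) (sym (pos-* 2 k))) (trans (m-n≡m⊖n (2 ℕ.* k) 2) (⊖-≥ 2≤2k)))))
      where
      2≤2k : 2 ≤ 2 ℕ.* k
      2≤2k = ℕ.≤-trans (s≤s (s≤s z≤n)) 6≤2k
      0<2k-2 : 0 < 2 ℕ.* k ℕ.∸ 2
      0<2k-2 = ℕ.≤-trans (s≤s z≤n) (ℕ.∸-monoˡ-≤ 2 6≤2k)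
      2k<n : 2 ℕ.* k < n
      2k<n = ℕ.<-≤-trans (ℕ.m<m+n (2 ℕ.* k) (ℕ.≤-trans (s≤s z≤n) 6≤2k)) (ℕ.≤-reflexive (sym (ℕ.*-distribʳ-+ k 2 2)))

    apart-by-4 : ∀ a b α → b ≡ a + + 4 → ⟨ a , α ⟩ ≢ ⟨ b , α ⟩
    apart-by-4 a b α = ⟨⟩-apart a b α (s≤s z≤n) (ℕ.<-≤-trans (s≤s (s≤s (s≤s (s≤s (s≤s z≤n))))) (ℕ.≤-trans 6≤2k 2k≤n))

  π-x^ : ∀ m → π (x^ m) ≡ D₈.⟨ + m , false ⟩
  π-x^ m = trans (cong π (x^≡⟨⟩ m)) (π-⟨⟩ (+ m) false)

  π-z : π z ≡ D₈.⟨ + 2 , false ⟩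
  π-z = trans (π-⟨⟩ (+ 2 * K) false) (D₈.⟨⟩-cong {a' = + 2} false (≡-mod-by-quotient C (trans (cong (+ 2 *_) K≡1+2C) (eq C))))
    where
    eq : ∀ C → + 2 * (+ 1 + + 2 * C) ≡ + 2 + C * (+ 4 * + 1)
    eq = solve-∀

  π-s₁ : π s₁ ≡ D₈.⟨ + 1 , true ⟩
  π-s₁ = trans (π-⟨⟩ (+ 2 * K - + 1) true) (D₈.⟨⟩-cong {a' = + 1} true (≡-mod-by-quotient C (trans (cong (λ K → + 2 * K - + 1) K≡1+2C) (eq C))))
    where
    eq : ∀ C → + 2 * (+ 1 + + 2 * C) - + 1 ≡ + 1 + C * (+ 4 * + 1)
    eq = solve-∀

  π-w₀ : π w₀ ≡ D₈.⟨ + 0 , true ⟩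
  π-w₀ = trans (π-⟨⟩ (+ 2 * K - + 2) true) (D₈.⟨⟩-cong {a' = + 0} true (≡-mod-by-quotient C (trans (cong (λ K → + 2 * K - + 2) K≡1+2C) (eq C))))
    where
    eq : ∀ C → + 2 * (+ 1 + + 2 * C) - + 2 ≡ + 0 + C * (+ 4 * + 1)
    eq = solve-∀

  -- x²A₁ consists of the rotations with exponent 2 mod 4, yA₁ of the reflections with exponent 0 mod 4.
  data InZ (g : G) : Set where
    rotation   : π g ≡ D₈.⟨ + 2 , false ⟩ → InZ g
    reflection : π g ≡ D₈.⟨ + 0 , true ⟩ → g ≢ w₀ → InZ g
    is-s₁      : g ≡ s₁ → InZ g
    is-t       : g ≡ t → InZ g
    is-s₂      : g ≡ s₂ → InZ g

  signature : ∀ {g} → InZ g → D₈.G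
  signature (rotation _)     = D₈.⟨ + 2 , false ⟩
  signature (reflection _ _) = D₈.⟨ + 0 , true ⟩
  signature (is-s₁ _)        = D₈.⟨ + 1 , true ⟩
  signature (is-t _)         = D₈.⟨ - + 2 , true ⟩
  signature (is-s₂ _)        = D₈.⟨ - + 1 , true ⟩

  π-signature : ∀ {g} (gZ : InZ g) → π g ≡ signature gZ
  π-signature (rotation πg)     = πg
  π-signature (reflection πg _) = πg
  π-signature (is-s₁ refl)      = π-s₁
  π-signature (is-t refl)       = π-⟨⟩ (- + 2) true
  π-signature (is-s₂ refl)      = π-⟨⟩ (- + 1) true

  Z-signatures : List D₈.G
  Z-signatures = D₈.⟨ + 2 , false ⟩ ∷ D₈.⟨ + 0 , true ⟩ ∷ D₈.⟨ + 1 , true ⟩ ∷ D₈.⟨ + 2 , true ⟩ ∷ D₈.⟨ + 3 , true ⟩ ∷ []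

  π∈Z-signatures : ∀ {g} → InZ g → π g ∈ Z-signatures
  π∈Z-signatures gZ = subst (_∈ Z-signatures) (sym (π-signature gZ)) (signature∈Z-signatures gZ)
    where
    signature∈Z-signatures : ∀ {g} (gZ : InZ g) → signature gZ ∈ Z-signatures
    signature∈Z-signatures (rotation _)     = here refl
    signature∈Z-signatures (reflection _ _) = there (here refl)
    signature∈Z-signatures (is-s₁ _)        = there (there (here refl))
    signature∈Z-signatures (is-t _)         = there (there (there (here refl)))
    signature∈Z-signatures (is-s₂ _)        = there (there (there (there (here refl))))

  ∉Z : ∀ {g σ} → π g ≡ σ → False (σ D₈.∈? Z-signatures) → ¬ InZ g
  ∉Z πg≡σ σ∉Z-signatures gZ = toWitnessFalse σ∉Z-signatures (subst (_∈ Z-signatures) πg≡σ (π∈Z-signatures gZ))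

  -- For a concrete σ this list normalises, so a membership proof splits into the few
  -- possible signatures of a factorisation inside Z.
  factorisations : D₈.G → List (D₈.G × D₈.G)
  factorisations σ = filter (λ p → proj₁ p D₈.∙ proj₂ p D₈.≟G σ) (cartesianProduct Z-signatures Z-signatures)

  π-factorisation : ∀ {a b h σ} → InZ a → InZ b → a ∙ b ≡ h → π h ≡ σ → (π a , π b) ∈ factorisations σ
  π-factorisation {a} {b} aZ bZ refl refl =
    ∈-filter⁺ (λ p → proj₁ p D₈.∙ proj₂ p D₈.≟G π (a ∙ b)) (∈-cartesianProduct⁺ (π∈Z-signatures aZ) (π∈Z-signatures bZ)) (sym (π-∙ a b))

  private
    clash : ∀ {g σ} (gZ : InZ g) → π g ≡ σ → signature gZ ≢ σ → ∀ {A : Set} → A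
    clash gZ πg≡σ ne = contradiction (trans (sym (π-signature gZ)) πg≡σ) ne

  reflection-by-signature : ∀ {a} → InZ a → π a ≡ D₈.⟨ + 0 , true ⟩ → a ≢ w₀
  reflection-by-signature (reflection _ a≢w₀) _ = a≢w₀
  reflection-by-signature aZ@(rotation _) πa = clash aZ πa λ ()
  reflection-by-signature aZ@(is-s₁ _)    πa = clash aZ πa λ ()
  reflection-by-signature aZ@(is-t _)     πa = clash aZ πa λ ()
  reflection-by-signature aZ@(is-s₂ _)    πa = clash aZ πa λ ()

  s₁-by-signature : ∀ {a} → InZ a → π a ≡ D₈.⟨ + 1 , true ⟩ → a ≡ s₁
  s₁-by-signature (is-s₁ a≡s₁) _ = a≡s₁
  s₁-by-signature aZ@(rotation _)     πa = clash aZ πa λ ()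
  s₁-by-signature aZ@(reflection _ _) πa = clash aZ πa λ ()
  s₁-by-signature aZ@(is-t _)         πa = clash aZ πa λ ()
  s₁-by-signature aZ@(is-s₂ _)        πa = clash aZ πa λ ()

  t-by-signature : ∀ {a} → InZ a → π a ≡ D₈.⟨ + 2 , true ⟩ → a ≡ t
  t-by-signature (is-t a≡t) _ = a≡t
  t-by-signature aZ@(rotation _)     πa = clash aZ πa λ ()
  t-by-signature aZ@(reflection _ _) πa = clash aZ πa λ ()
  t-by-signature aZ@(is-s₁ _)        πa = clash aZ πa λ ()
  t-by-signature aZ@(is-s₂ _)        πa = clash aZ πa λ ()

  s₂-by-signature : ∀ {a} → InZ a → π a ≡ D₈.⟨ + 3 , true ⟩ → a ≡ s₂
  s₂-by-signature (is-s₂ a≡s₂) _ = a≡s₂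
  s₂-by-signature aZ@(rotation _)     πa = clash aZ πa λ ()
  s₂-by-signature aZ@(reflection _ _) πa = clash aZ πa λ ()
  s₂-by-signature aZ@(is-s₁ _)        πa = clash aZ πa λ ()
  s₂-by-signature aZ@(is-t _)         πa = clash aZ πa λ ()

  Pivot : G → G → Set
  Pivot r h = ∀ {a b} → InZ a → InZ b → a ∙ b ≡ h → a ≡ r ⊎ b ≡ r

  private
    t⁻¹≡t : t ⁻¹ ≡ t
    t⁻¹≡t = sym (inverseʳ-unique t t t∙t≡e)

    left-factor : ∀ {a c} → a ∙ t ≡ c → a ≡ c ∙ t
    left-factor {a} {c} a∙t≡c = trans (x≈z//y a t c a∙t≡c) (cong (c ∙_) t⁻¹≡t)

    right-factor : ∀ {b c} → t ∙ b ≡ c → b ≡ t ∙ c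
    right-factor {b} {c} t∙b≡c = trans (y≈x\\z t b c t∙b≡c) (cong (_∙ c) t⁻¹≡t)

  rotation-pivot : ∀ {h} → π h ≡ D₈.⟨ + 2 , false ⟩ → h ≢ z → Pivot t h
  rotation-pivot {h} πh h≢z aZ bZ ab≡h = by-signatures aZ bZ ab≡h (π-factorisation aZ bZ ab≡h πh)
    where
    by-signatures : ∀ {a b} → InZ a → InZ b → a ∙ b ≡ h → (π a , π b) ∈ factorisations D₈.⟨ + 2 , false ⟩ → a ≡ t ⊎ b ≡ t
    by-signatures aZ bZ ab≡h (here eq)                         = inj₂ (t-by-signature bZ (cong proj₂ eq))
    by-signatures aZ bZ ab≡h (there (here eq))                 = contradiction
      (trans (sym ab≡h) (trans (cong₂ _∙_ (s₁-by-signature aZ (cong proj₁ eq)) (s₂-by-signature bZ (cong proj₂ eq))) s₁∙s₂≡z)) h≢z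
    by-signatures aZ bZ ab≡h (there (there (here eq)))         = inj₁ (t-by-signature aZ (cong proj₁ eq))
    by-signatures aZ bZ ab≡h (there (there (there (here eq)))) = contradiction
      (trans (sym ab≡h) (trans (cong₂ _∙_ (s₂-by-signature aZ (cong proj₁ eq)) (s₁-by-signature bZ (cong proj₂ eq))) s₂∙s₁≡z)) h≢z

  z-pivot : Pivot s₂ z
  z-pivot aZ bZ ab≡z = by-signatures aZ bZ ab≡z (π-factorisation aZ bZ ab≡z π-z)
    where
    z∙t≡w₀ : z ∙ t ≡ w₀
    z∙t≡w₀ = trans (z-central t) t∙z≡w₀
    by-signatures : ∀ {a b} → InZ a → InZ b → a ∙ b ≡ z → (π a , π b) ∈ factorisations D₈.⟨ + 2 , false ⟩ → a ≡ s₂ ⊎ b ≡ s₂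
    by-signatures aZ bZ ab≡z (here eq)                         =
      contradiction (trans (left-factor (subst (λ b → _ ∙ b ≡ z) (t-by-signature bZ (cong proj₂ eq)) ab≡z)) z∙t≡w₀)
                    (reflection-by-signature aZ (cong proj₁ eq))
    by-signatures aZ bZ ab≡z (there (here eq))                 = inj₂ (s₂-by-signature bZ (cong proj₂ eq))
    by-signatures aZ bZ ab≡z (there (there (here eq)))         =
      contradiction (trans (right-factor (subst (λ a → a ∙ _ ≡ z) (t-by-signature aZ (cong proj₁ eq)) ab≡z)) t∙z≡w₀)
                    (reflection-by-signature bZ (cong proj₂ eq))
    by-signatures aZ bZ ab≡z (there (there (there (here eq)))) = inj₁ (s₂-by-signature aZ (cong proj₁ eq))

  reflection-pivot : ∀ {h} → π h ≡ D₈.⟨ + 0 , true ⟩ → Pivot t h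
  reflection-pivot {h} πh aZ bZ ab≡h = by-signatures aZ bZ (π-factorisation aZ bZ ab≡h πh)
    where
    by-signatures : ∀ {a b} → InZ a → InZ b → (π a , π b) ∈ factorisations D₈.⟨ + 0 , true ⟩ → a ≡ t ⊎ b ≡ t
    by-signatures aZ bZ (here eq)         = inj₂ (t-by-signature bZ (cong proj₂ eq))
    by-signatures aZ bZ (there (here eq)) = inj₁ (t-by-signature aZ (cong proj₁ eq))

  s₁-pivot : Pivot s₂ s₁
  s₁-pivot aZ bZ ab≡s₁ = by-signatures aZ bZ (π-factorisation aZ bZ ab≡s₁ π-s₁)
    where
    by-signatures : ∀ {a b} → InZ a → InZ b → (π a , π b) ∈ factorisations D₈.⟨ + 1 , true ⟩ → a ≡ s₂ ⊎ b ≡ s₂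
    by-signatures aZ bZ (here eq)         = inj₂ (s₂-by-signature bZ (cong proj₂ eq))
    by-signatures aZ bZ (there (here eq)) = inj₁ (s₂-by-signature aZ (cong proj₁ eq))

  s₂-pivot : Pivot s₁ s₂
  s₂-pivot aZ bZ ab≡s₂ = by-signatures aZ bZ (π-factorisation aZ bZ ab≡s₂ (π-⟨⟩ (- + 1) true))
    where
    by-signatures : ∀ {a b} → InZ a → InZ b → (π a , π b) ∈ factorisations D₈.⟨ + 3 , true ⟩ → a ≡ s₁ ⊎ b ≡ s₁
    by-signatures aZ bZ (here eq)         = inj₂ (s₁-by-signature bZ (cong proj₂ eq))
    by-signatures aZ bZ (there (here eq)) = inj₁ (s₁-by-signature aZ (cong proj₁ eq))

  pivot : ∀ {h} → InZ h → h ≢ t → ∃ λ r → Pivot r h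
  pivot {h} (rotation πh) h≢t with h ≟G z
  ... | yes h≡z = s₂ , subst (Pivot s₂) (sym h≡z) z-pivot
  ... | no  h≢z = t , rotation-pivot πh h≢z
  pivot (reflection πh _) _   = t , reflection-pivot πh
  pivot (is-s₁ h≡s₁) _        = s₂ , subst (Pivot s₂) (sym h≡s₁) s₁-pivot
  pivot (is-t h≡t) h≢t        = contradiction h≡t h≢t
  pivot (is-s₂ h≡s₂) _        = s₁ , subst (Pivot s₁) (sym h≡s₂) s₂-pivot

  InZ? : Decidable InZ
  InZ? g = map′ from to
    ((π g D₈.≟G D₈.⟨ + 2 , false ⟩) ⊎-dec ((π g D₈.≟G D₈.⟨ + 0 , true ⟩) ×-dec ¬? (g ≟G w₀)) ⊎-dec
     (g ≟G s₁) ⊎-dec (g ≟G t) ⊎-dec (g ≟G s₂))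
    where
    from : _ → InZ g
    from (inj₁ πg)                       = rotation πg
    from (inj₂ (inj₁ (πg , g≢w₀)))       = reflection πg g≢w₀
    from (inj₂ (inj₂ (inj₁ g≡s₁)))       = is-s₁ g≡s₁
    from (inj₂ (inj₂ (inj₂ (inj₁ g≡t)))) = is-t g≡t
    from (inj₂ (inj₂ (inj₂ (inj₂ g≡s₂)))) = is-s₂ g≡s₂
    to : InZ g → _
    to (rotation πg)        = inj₁ πg
    to (reflection πg g≢w₀) = inj₂ (inj₁ (πg , g≢w₀))
    to (is-s₁ g≡s₁)         = inj₂ (inj₂ (inj₁ g≡s₁))
    to (is-t g≡t)           = inj₂ (inj₂ (inj₂ (inj₁ g≡t)))
    to (is-s₂ g≡s₂)         = inj₂ (inj₂ (inj₂ (inj₂ g≡s₂)))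

  private
    exp-mod-4 : ∀ {g σ} → π g ≡ σ → exp g ≡ D₈.exp σ [mod D₈.N ]
    exp-mod-4 {g} πg≡σ = ≡-mod-trans (≡-mod-sym (D₈.exp-⟨⟩ (exp g) (bit g))) (≡⇒≡-mod (cong D₈.exp πg≡σ))

    4j≡0 : ∀ j → + (4 ℕ.* j) ≡ + 0 [mod D₈.N ]
    4j≡0 j = ≡-mod-by-quotient (+ j) (trans (pos-* 4 j) (eq (+ j)))
      where
      eq : ∀ j → + 4 * j ≡ + 0 + j * (+ 4 * + 1)
      eq = solve-∀

    π-x²x^4j : ∀ j → π (x^ 2 ∙ x^ (4 ℕ.* j)) ≡ D₈.⟨ + 2 , false ⟩
    π-x²x^4j j = begin
      π (x^ 2 ∙ x^ (4 ℕ.* j))      ≡⟨ cong π (x^-∙-x^ 2 (4 ℕ.* j)) ⟩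
      π (x^ (2 ℕ.+ 4 ℕ.* j))       ≡⟨ π-x^ (2 ℕ.+ 4 ℕ.* j) ⟩
      D₈.⟨ + (2 ℕ.+ 4 ℕ.* j) , false ⟩ ≡⟨ D₈.⟨⟩-cong false (+-cong-mod (≡⇒≡-mod {a = + 2} refl) (4j≡0 j)) ⟩
      D₈.⟨ + 2 + + 0 , false ⟩     ∎
      where open ≡-Reasoning

    π-yx^4j : ∀ j → π (y ∙ x^ (4 ℕ.* j)) ≡ D₈.⟨ + 0 , true ⟩
    π-yx^4j j = trans (cong π (yx^≡⟨⟩ (4 ℕ.* j))) (trans (π-⟨⟩ (+ (4 ℕ.* j)) true) (D₈.⟨⟩-cong true (4j≡0 j)))

  ∈Z⇒InZ : ∀ {g} → g ∈Z → InZ g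
  ∈Z⇒InZ (inj₁ (a , (j , a≡x^4j) , g≡x²a)) =
    rotation (trans (cong π (trans g≡x²a (cong (x^ 2 ∙_) a≡x^4j))) (π-x²x^4j j))
  ∈Z⇒InZ {g} (inj₂ (inj₁ (a , (j , a≡x^4j) , a≢x^2[k-1] , g≡ya))) =
    reflection (trans (cong π (trans g≡ya (cong (y ∙_) a≡x^4j))) (π-yx^4j j))
               (λ g≡w₀ → a≢x^2[k-1] (∙-cancelˡ y a _ (trans (sym g≡ya) (trans g≡w₀ (sym yx^2[k-1]≡w₀)))))
  ∈Z⇒InZ (inj₂ (inj₂ (inj₁ g≡yx^2k-1)))    = is-s₁ (trans g≡yx^2k-1 yx^2k-1≡s₁)
  ∈Z⇒InZ (inj₂ (inj₂ (inj₂ (inj₁ g≡yx^-2)))) = is-t (trans g≡yx^-2 (yx^-≡⟨⟩ 2))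
  ∈Z⇒InZ (inj₂ (inj₂ (inj₂ (inj₂ g≡yx^-1)))) = is-s₂ (trans g≡yx^-1 (yx^-≡⟨⟩ 1))

  InZ⇒∈Z : ∀ {g} → InZ g → g ∈Z
  InZ⇒∈Z {g} (rotation πg) = inj₁ (x^ (4 ℕ.* j) , (j , refl) , (begin
    g                           ≡⟨ rotation-η (cong proj₂ πg) ⟨
    x^ (toℕ (proj₁ g))          ≡⟨ cong x^ (residue-decompose 4 (exp-mod-4 πg) (s≤s (s≤s (s≤s z≤n)))) ⟩
    x^ (2 ℕ.+ 4 ℕ.* j)          ≡⟨ x^-∙-x^ 2 (4 ℕ.* j) ⟨
    x^ 2 ∙ x^ (4 ℕ.* j)         ∎))
    where
    open ≡-Reasoning
    j = toℕ (proj₁ g) ℕ./ 4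
  InZ⇒∈Z {g} (reflection πg g≢w₀) = inj₂ (inj₁ (x^ (4 ℕ.* j) , (j , refl) ,
    (λ x^4j≡x^2[k-1] → g≢w₀ (trans g≡yx^4j (trans (cong (y ∙_) x^4j≡x^2[k-1]) yx^2[k-1]≡w₀))) , g≡yx^4j))
    where
    j = toℕ (proj₁ g) ℕ./ 4
    g≡yx^4j : g ≡ y ∙ x^ (4 ℕ.* j)
    g≡yx^4j = trans (sym (reflection-η (cong proj₂ πg))) (cong (λ m → y ∙ x^ m) (residue-decompose 4 (exp-mod-4 πg) (s≤s z≤n)))
  InZ⇒∈Z (is-s₁ g≡s₁) = inj₂ (inj₂ (inj₁ (trans g≡s₁ (sym yx^2k-1≡s₁))))
  InZ⇒∈Z (is-t g≡t)   = inj₂ (inj₂ (inj₂ (inj₁ (trans g≡t (sym (yx^-≡⟨⟩ 2))))))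
  InZ⇒∈Z (is-s₂ g≡s₂) = inj₂ (inj₂ (inj₂ (inj₂ (trans g≡s₂ (sym (yx^-≡⟨⟩ 1))))))

  parity-z : parity z ≡ false
  parity-z = trans (parity-π z) (cong D₈.parity π-z)

  parity-x : parity x ≡ true
  parity-x = trans (parity-π x) (cong D₈.parity (π-⟨⟩ (+ 1) false))

  parity-t : parity t ≡ false
  parity-t = trans (parity-π t) (cong D₈.parity (π-⟨⟩ (- + 2) true))

  parity-∙z : ∀ g → parity (g ∙ z) ≡ parity g
  parity-∙z g = trans (parity-∙ g z) (trans (cong (parity g xor_) parity-z) (xor-identityʳ (parity g)))

  odd-∈Z : ∀ {g} → InZ g → parity g ≡ true → g ≡ s₁ ⊎ g ≡ s₂
  odd-∈Z {g} (rotation πg)     odd = contradiction (trans (sym odd) (trans (parity-π g) (cong D₈.parity πg))) λ ()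
  odd-∈Z {g} (reflection πg _) odd = contradiction (trans (sym odd) (trans (parity-π g) (cong D₈.parity πg))) λ ()
  odd-∈Z (is-s₁ g≡s₁)          _   = inj₁ g≡s₁
  odd-∈Z (is-t g≡t)            odd = contradiction (trans (sym odd) (trans (cong parity g≡t) parity-t)) λ ()
  odd-∈Z (is-s₂ g≡s₂)          _   = inj₂ g≡s₂

  infix 4 _∼_
  _∼_ : G → G → Set
  g ∼ h = (parity g ≡ false × h ≡ g) ⊎ (parity g ≡ true × (h ≡ g ⊎ h ≡ g ∙ z))

  infix 4 _∼?_
  _∼?_ : ∀ g h → Dec (g ∼ h)
  g ∼? h = ((parity g Bool.≟ false) ×-dec (h ≟G g)) ⊎-dec ((parity g Bool.≟ true) ×-dec ((h ≟G g) ⊎-dec (h ≟G g ∙ z)))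

  ∼-refl : ∀ {g} → g ∼ g
  ∼-refl {g} = by-parity (parity g) refl
    where
    by-parity : ∀ b → parity g ≡ b → g ∼ g
    by-parity false even = inj₁ (even , refl)
    by-parity true  odd  = inj₂ (odd , inj₁ refl)

  ∼-sym : ∀ {g h} → g ∼ h → h ∼ g
  ∼-sym (inj₁ (even , refl))         = inj₁ (even , refl)
  ∼-sym (inj₂ (odd , inj₁ refl))     = inj₂ (odd , inj₁ refl)
  ∼-sym {g} (inj₂ (odd , inj₂ refl)) = inj₂ (trans (parity-∙z g) odd , inj₂ (sym (∙z-involutive g)))

  ∼-trans : ∀ {g h l} → g ∼ h → h ∼ l → g ∼ l
  ∼-trans (inj₁ (_ , refl))                h∼l                          = h∼l
  ∼-trans (inj₂ (_ , inj₁ refl))           h∼l                          = h∼l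
  ∼-trans {g} (inj₂ (odd , inj₂ refl)) (inj₁ (even , _))                = contradiction (trans (sym even) (trans (parity-∙z g) odd)) λ ()
  ∼-trans (inj₂ (odd , inj₂ refl))     (inj₂ (_ , inj₁ refl))           = inj₂ (odd , inj₂ refl)
  ∼-trans {g} (inj₂ (odd , inj₂ refl)) (inj₂ (_ , inj₂ refl))           = inj₂ (odd , inj₁ (∙z-involutive g))

  ∼-unit : ∀ g → e ∼ g → g ≡ e
  ∼-unit g (inj₁ (_ , g≡e))  = g≡e
  ∼-unit g (inj₂ (odd , _)) = contradiction (trans (sym odd) parity-e) λ ()

  z⁻¹≡z : z ⁻¹ ≡ z
  z⁻¹≡z = sym (inverseʳ-unique z z z∙z≡e)

  ∼-⁻¹ : ∀ g h → g ∼ h → g ⁻¹ ∼ h ⁻¹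
  ∼-⁻¹ g h (inj₁ (even , refl))     = inj₁ (trans (parity-⁻¹ g) even , refl)
  ∼-⁻¹ g h (inj₂ (odd , inj₁ refl)) = inj₂ (trans (parity-⁻¹ g) odd , inj₁ refl)
  ∼-⁻¹ g h (inj₂ (odd , inj₂ refl)) = inj₂ (trans (parity-⁻¹ g) odd , inj₂ (begin
    (g ∙ z) ⁻¹      ≡⟨ ⁻¹-anti-homo-∙ g z ⟩
    z ⁻¹ ∙ g ⁻¹     ≡⟨ cong (_∙ g ⁻¹) z⁻¹≡z ⟩
    z ∙ g ⁻¹        ≡⟨ z-central (g ⁻¹) ⟩
    g ⁻¹ ∙ z        ∎))
    where open ≡-Reasoning

  ∼-Z : ∀ g h → g ∼ h → InZ g → InZ h
  ∼-Z g h (inj₁ (_ , refl))          gZ = gZ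
  ∼-Z g h (inj₂ (_ , inj₁ refl))     gZ = gZ
  ∼-Z g h (inj₂ (odd , inj₂ refl))   gZ with odd-∈Z gZ odd
  ... | inj₁ g≡s₁ = is-s₂ (trans (cong (_∙ z) g≡s₁) s₁∙z≡s₂)
  ... | inj₂ g≡s₂ = is-s₁ (trans (cong (_∙ z) g≡s₂) (trans (cong (_∙ z) (sym s₁∙z≡s₂)) (∙z-involutive s₁)))

  private
    ∙z∙≡∙∙z : ∀ a b → (a ∙ z) ∙ b ≡ (a ∙ b) ∙ z
    ∙z∙≡∙∙z a b = trans (∙-assoc a z b) (trans (cong (a ∙_) (z-central b)) (sym (∙-assoc a b z)))

    odd-∼-∙z : ∀ {u} → parity u ≡ true → u ∼ u ∙ z
    odd-∼-∙z odd = inj₂ (odd , inj₂ refl)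

    ∙z≡⇒≡∙z : ∀ {u v} → u ∙ z ≡ v → u ≡ v ∙ z
    ∙z≡⇒≡∙z {u} u∙z≡v = trans (sym (∙z-involutive u)) (cong (_∙ z) u∙z≡v)

  module _ (r s : G) where

    private
      F : G → G × G → ℕ
      F g p = 𝟙 (((r ∼? proj₁ p) ×-dec (s ∼? proj₂ p)) ×-dec (proj₁ p ∙ proj₂ p ≟G g))

      -- σ moves z onto an odd factor, matching the factorisations of g ∙ z with those of g.
      shift : Bool → G → G → G × G
      shift true  a b = a ∙ z , b
      shift false a b = a , b ∙ z

      σ : G × G → G × G
      σ p = shift (parity (proj₁ p)) (proj₁ p) (proj₂ p)

      σ-involutive : ∀ p → σ (σ p) ≡ p
      σ-involutive (a , b) = by-parity (parity a) refl
        where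
        by-parity : ∀ β → parity a ≡ β → σ (shift β a b) ≡ (a , b)
        by-parity true  odd  = trans (cong (λ β → shift β (a ∙ z) b) (trans (parity-∙z a) odd)) (cong (_, b) (∙z-involutive a))
        by-parity false even = trans (cong (λ β → shift β a (b ∙ z)) even) (cong (a ,_) (∙z-involutive b))

      F-∙z : ∀ g → parity g ≡ true → ∀ p → F (g ∙ z) p ≡ F g (σ p)
      F-∙z g odd (a , b) = by-parity (parity a) refl
        where
        by-parity : ∀ β → parity a ≡ β → F (g ∙ z) (a , b) ≡ F g (shift β a b)
        by-parity true odd-a = 𝟙-cong
          (((r ∼? a) ×-dec (s ∼? b)) ×-dec (a ∙ b ≟G g ∙ z)) (((r ∼? a ∙ z) ×-dec (s ∼? b)) ×-dec ((a ∙ z) ∙ b ≟G g))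
          (λ ((r∼a , s∼b) , ab≡gz) → (∼-trans r∼a (odd-∼-∙z odd-a) , s∼b) , trans (∙z∙≡∙∙z a b) (trans (cong (_∙ z) ab≡gz) (∙z-involutive g)))
          (λ ((r∼az , s∼b) , azb≡g) → (∼-trans r∼az (∼-sym (odd-∼-∙z odd-a)) , s∼b) , ∙z≡⇒≡∙z (trans (sym (∙z∙≡∙∙z a b)) azb≡g))
        by-parity false even-a = 𝟙-cong
          (((r ∼? a) ×-dec (s ∼? b)) ×-dec (a ∙ b ≟G g ∙ z)) (((r ∼? a) ×-dec (s ∼? b ∙ z)) ×-dec (a ∙ (b ∙ z) ≟G g))
          (λ ((r∼a , s∼b) , ab≡gz) →
            (r∼a , ∼-trans s∼b (odd-∼-∙z (odd-b ab≡gz))) , trans (sym (∙-assoc a b z)) (trans (cong (_∙ z) ab≡gz) (∙z-involutive g)))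
          (λ ((r∼a , s∼bz) , abz≡g) → (r∼a , ∼-trans s∼bz (∼-sym (odd-∼-∙z (odd-b-from-bz abz≡g)))) , ∙z≡⇒≡∙z (trans (∙-assoc a b z) abz≡g))
          where
          odd-right : ∀ {c h} → a ∙ c ≡ h → parity h ≡ true → parity c ≡ true
          odd-right {c} ac≡h odd-h = trans (sym (cong (_xor parity c) even-a)) (trans (sym (parity-∙ a c)) (trans (cong parity ac≡h) odd-h))
          odd-b : a ∙ b ≡ g ∙ z → parity b ≡ true
          odd-b ab≡gz = odd-right ab≡gz (trans (parity-∙z g) odd)
          odd-b-from-bz : a ∙ (b ∙ z) ≡ g → parity b ≡ true
          odd-b-from-bz abz≡g = trans (sym (parity-∙z b)) (odd-right abz≡g odd)

    count-∙z : ∀ g → parity g ≡ true → count (r ∼?_) (s ∼?_) (g ∙ z) ≡ count (r ∼?_) (s ∼?_) g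
    count-∙z g odd = trans (∑-cong pairs (F-∙z g odd)) (∑-involution pairs-enumerate σ σ-involutive (F g))

  ∼-mul : ∀ r s g h → g ∼ h → coeff _∼_ _∼?_ r s g ≡ coeff _∼_ _∼?_ r s h
  ∼-mul r s g h (inj₁ (_ , refl))        = refl
  ∼-mul r s g h (inj₂ (_ , inj₁ refl))   = refl
  ∼-mul r s g h (inj₂ (odd , inj₂ refl)) =
    trans (coeff≡count _∼_ _∼?_ r s g) (trans (sym (count-∙z r s g odd)) (sym (coeff≡count _∼_ _∼?_ r s (g ∙ z))))

  ∼-isSRing : IsSRing _∼_
  ∼-isSRing = record
    { isEquivalence = record { refl = ∼-refl ; sym = ∼-sym ; trans = ∼-trans }
    ; R?            = _∼?_
    ; unit-basic    = ∼-unit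
    ; inv-closed    = ∼-⁻¹
    ; mul-closed    = ∼-mul
    }

  private
    x^2k*i≡⟨⟩ : ∀ i → x^ (2 ℕ.* k ℕ.* i) ≡ ⟨ + 2 * K * + i , false ⟩
    x^2k*i≡⟨⟩ i = trans (x^≡⟨⟩ _) (cong ⟨_, false ⟩ (trans (pos-* (2 ℕ.* k) i) (cong (_* + i) (pos-* 2 k))))

    x^2k*0≡e : x^ (2 ℕ.* k ℕ.* 0) ≡ e
    x^2k*0≡e = cong x^ (ℕ.*-zeroʳ (2 ℕ.* k))

    x^2k*1≡z : x^ (2 ℕ.* k ℕ.* 1) ≡ z
    x^2k*1≡z = trans (cong x^ (ℕ.*-identityʳ (2 ℕ.* k))) x^2k≡z

  A₀-elements : ∀ {a} → a ∈A₀ → a ≡ e ⊎ a ≡ z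
  A₀-elements {a} (i , a≡x^2ki) = by-residue (i ℕ.% 2) (residue-decompose 2 (residue-mod 2 i) (m%n<n i 2)) (m%n<n i 2)
    where
    q = i ℕ./ 2
    a≡⟨⟩ : a ≡ ⟨ + 2 * K * + i , false ⟩
    a≡⟨⟩ = trans a≡x^2ki (x^2k*i≡⟨⟩ i)
    eq₀ : ∀ K q → + 2 * K * (+ 0 + + 2 * q) ≡ + 0 + q * (+ 4 * K)
    eq₀ = solve-∀
    eq₁ : ∀ K q → + 2 * K * (+ 1 + + 2 * q) ≡ + 2 * K + q * (+ 4 * K)
    eq₁ = solve-∀
    +i≡ : ∀ r → i ≡ r ℕ.+ 2 ℕ.* q → + i ≡ + r + + 2 * + q
    +i≡ r i≡ = trans (cong +_ i≡) (trans (pos-+ r (2 ℕ.* q)) (cong (λ v → + r + v) (pos-* 2 q)))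
    by-residue : ∀ r → i ≡ r ℕ.+ 2 ℕ.* q → r < 2 → a ≡ e ⊎ a ≡ z
    by-residue 0 i≡ _ = inj₁ (trans a≡⟨⟩ (⟨⟩-cong {a' = + 0} false
      (≡-mod-by-quotient (+ q) (trans (cong (λ v → + 2 * K * v) (+i≡ 0 i≡)) (eq₀ K (+ q))))))
    by-residue 1 i≡ _ = inj₂ (trans a≡⟨⟩ (⟨⟩-cong {a' = + 2 * K} false
      (≡-mod-by-quotient (+ q) (trans (cong (λ v → + 2 * K * v) (+i≡ 1 i≡)) (eq₁ K (+ q))))))
    by-residue (ℕ.suc (ℕ.suc _)) _ (s≤s (s≤s ()))

  private
    parity-x^2m : ∀ m → parity (x^ (2 ℕ.* m)) ≡ false
    parity-x^2m m = parity-unique {x^ (2 ℕ.* m)} false (≡-mod-trans (≡-mod-divisor 2∣N (exp-red (2 ℕ.* m)))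
      (≡-mod-by-quotient (+ m) (trans (pos-* 2 m) (eq (+ m)))))
      where
      eq : ∀ m → + 2 * m ≡ + 0 + m * + 2
      eq = solve-∀

    parity-y : parity y ≡ false
    parity-y = trans (parity-π y) (cong D₈.parity (trans (cong π y≡⟨⟩) (π-⟨⟩ (+ 0) true)))

    parity-y^ : ∀ β → parity (y^ β) ≡ false
    parity-y^ false = parity-e
    parity-y^ true  = parity-y

  U⇒even : ∀ {g} → g ∈U → parity g ≡ false
  U⇒even {g} (a₀ , a₁ , b , (i , a₀≡x^2ki) , (j , a₁≡x^4j) , (β , b≡y^β) , g≡a₀a₁b) = begin
    parity g                                 ≡⟨ cong parity g≡a₀a₁b ⟩
    parity (a₀ ∙ a₁ ∙ b)                     ≡⟨ parity-∙ (a₀ ∙ a₁) b ⟩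
    parity (a₀ ∙ a₁) xor parity b            ≡⟨ cong (_xor parity b) (parity-∙ a₀ a₁) ⟩
    (parity a₀ xor parity a₁) xor parity b   ≡⟨ cong₂ (λ u v → (u xor v) xor parity b) even-a₀ even-a₁ ⟩
    parity b                                 ≡⟨ trans (cong parity b≡y^β) (parity-y^ β) ⟩
    false                                    ∎
    where
    open ≡-Reasoning
    even-a₀ : parity a₀ ≡ false
    even-a₀ = trans (cong parity (trans a₀≡x^2ki (cong x^ (ℕ.*-assoc 2 k i)))) (parity-x^2m (k ℕ.* i))
    even-a₁ : parity a₁ ≡ false
    even-a₁ = trans (cong parity (trans a₁≡x^4j (cong x^ (ℕ.*-assoc 2 2 j)))) (parity-x^2m (2 ℕ.* j))

  even-rotation∈A₀A₁ : ∀ {g} → bit g ≡ false → parity g ≡ false → ∃₂ λ i j → g ≡ x^ (2 ℕ.* k ℕ.* i) ∙ x^ (4 ℕ.* j)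
  even-rotation∈A₀A₁ {g} rot even = by-residue (m ℕ.% 4) (residue-decompose 4 (residue-mod 4 m) (m%n<n m 4)) (m%n<n m 4)
    where
    m = toℕ (proj₁ g)
    j = m ℕ./ 4
    g≡x^m : g ≡ x^ m
    g≡x^m = sym (rotation-η rot)
    +m≡ : ∀ r → m ≡ r ℕ.+ 4 ℕ.* j → + m ≡ + r + + 4 * + j
    +m≡ r m≡ = trans (cong +_ m≡) (trans (pos-+ r (4 ℕ.* j)) (cong (λ v → + r + v) (pos-* 4 j)))
    odd-residue : ∀ r q → m ≡ r ℕ.+ 4 ℕ.* j → + r + + 4 * + j ≡ + 1 + q * + 2 → ∀ {A : Set} → A
    odd-residue r q m≡ odd = contradiction (trans (sym even) (parity-unique {g} true (≡-mod-by-quotient q (trans (+m≡ r m≡) odd)))) λ ()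
    by-residue : ∀ r → m ≡ r ℕ.+ 4 ℕ.* j → r < 4 → ∃₂ λ i j → g ≡ x^ (2 ℕ.* k ℕ.* i) ∙ x^ (4 ℕ.* j)
    by-residue 0 m≡ _ = 0 , j , (begin
      g                                    ≡⟨ trans g≡x^m (cong x^ m≡) ⟩
      x^ (4 ℕ.* j)                         ≡⟨ ∙-identityˡ (x^ (4 ℕ.* j)) ⟨
      e ∙ x^ (4 ℕ.* j)                     ≡⟨ cong (_∙ x^ (4 ℕ.* j)) x^2k*0≡e ⟨
      x^ (2 ℕ.* k ℕ.* 0) ∙ x^ (4 ℕ.* j)    ∎)
      where open ≡-Reasoning
    by-residue 1 m≡ _ = odd-residue 1 (+ 2 * + j) m≡ (eq (+ j))
      where
      eq : ∀ j → + 1 + + 4 * j ≡ + 1 + + 2 * j * + 2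
      eq = solve-∀
    by-residue 2 m≡ _ = 1 , j' , (begin
      g                                    ≡⟨ trans g≡x^m (x^≡⟨⟩ m) ⟩
      ⟨ + m , false ⟩                      ≡⟨ ⟨⟩-cong {a' = + 2 * K + + (4 ℕ.* j')} false (≡-mod-by-quotient (- + 1) m≡2K+4j'-N) ⟩
      ⟨ + 2 * K + + (4 ℕ.* j') , false ⟩   ≡⟨ ⟨⟩-∙ (+ 2 * K) false (+ (4 ℕ.* j')) false ⟨
      z ∙ ⟨ + (4 ℕ.* j') , false ⟩         ≡⟨ cong₂ _∙_ x^2k*1≡z (x^≡⟨⟩ (4 ℕ.* j')) ⟨
      x^ (2 ℕ.* k ℕ.* 1) ∙ x^ (4 ℕ.* j')   ∎)
      where
      open ≡-Reasoning
      j' = j ℕ.+ k ℕ./ 2 ℕ.+ 1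
      +4j'≡ : + (4 ℕ.* j') ≡ + 4 * (+ j + C + + 1)
      +4j'≡ = trans (pos-* 4 j') (cong (+ 4 *_) (trans (pos-+ (j ℕ.+ k ℕ./ 2) 1) (cong (_+ + 1) (pos-+ j (k ℕ./ 2)))))
      eq : ∀ j C → + 2 + + 4 * j ≡ + 2 * (+ 1 + + 2 * C) + + 4 * (j + C + + 1) + - + 1 * (+ 4 * (+ 1 + + 2 * C))
      eq = solve-∀
      m≡2K+4j'-N : + m ≡ + 2 * K + + (4 ℕ.* j') + - + 1 * (+ 4 * K)
      m≡2K+4j'-N = begin
        + m                                                    ≡⟨ +m≡ 2 m≡ ⟩
        + 2 + + 4 * + j                                        ≡⟨ eq (+ j) C ⟩
        + 2 * (+ 1 + + 2 * C) + + 4 * (+ j + C + + 1) + - + 1 * (+ 4 * (+ 1 + + 2 * C))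
          ≡⟨ cong (λ K → + 2 * K + + 4 * (+ j + C + + 1) + - + 1 * (+ 4 * K)) K≡1+2C ⟨
        + 2 * K + + 4 * (+ j + C + + 1) + - + 1 * (+ 4 * K)    ≡⟨ cong (λ v → + 2 * K + v + - + 1 * (+ 4 * K)) +4j'≡ ⟨
        + 2 * K + + (4 ℕ.* j') + - + 1 * (+ 4 * K)             ∎
    by-residue 3 m≡ _ = odd-residue 3 (+ 1 + + 2 * + j) m≡ (eq (+ j))
      where
      eq : ∀ j → + 3 + + 4 * j ≡ + 1 + (+ 1 + + 2 * j) * + 2
      eq = solve-∀
    by-residue (ℕ.suc (ℕ.suc (ℕ.suc (ℕ.suc _)))) _ (s≤s (s≤s (s≤s (s≤s ()))))

  even⇒U : ∀ {g} → parity g ≡ false → g ∈U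
  even⇒U {g} even = by-bit (bit g) refl
    where
    by-bit : ∀ β → bit g ≡ β → g ∈U
    by-bit false rot = in-U (even-rotation∈A₀A₁ rot even)
      where
      in-U : (∃₂ λ i j → g ≡ x^ (2 ℕ.* k ℕ.* i) ∙ x^ (4 ℕ.* j)) → g ∈U
      in-U (i , j , g≡) = x^ (2 ℕ.* k ℕ.* i) , x^ (4 ℕ.* j) , e , (i , refl) , (j , refl) , (false , refl) ,
                          trans g≡ (sym (∙-identityʳ (x^ (2 ℕ.* k ℕ.* i) ∙ x^ (4 ℕ.* j))))
    by-bit true ref = in-U (even-rotation∈A₀A₁ {g ∙ y} (cong (_xor true) ref) (trans (parity-∙ g y) (cong₂ _xor_ even parity-y)))
      where
      in-U : (∃₂ λ i j → g ∙ y ≡ x^ (2 ℕ.* k ℕ.* i) ∙ x^ (4 ℕ.* j)) → g ∈U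
      in-U (i , j , gy≡) = x^ (2 ℕ.* k ℕ.* i) , x^ (4 ℕ.* j) , y , (i , refl) , (j , refl) , (true , refl) , (begin
        g              ≡⟨ ∙-identityʳ g ⟨
        g ∙ e          ≡⟨ cong (g ∙_) (reflection-involutive {y} refl) ⟨
        g ∙ (y ∙ y)    ≡⟨ ∙-assoc g y y ⟨
        (g ∙ y) ∙ y    ≡⟨ cong (_∙ y) gy≡ ⟩
        x^ (2 ℕ.* k ℕ.* i) ∙ x^ (4 ℕ.* j) ∙ y ∎)
        where open ≡-Reasoning
  SameBasic⇒∼ : ∀ {g h} → SameBasic g h → g ∼ h
  SameBasic⇒∼ (inj₁ (gU , h≡g)) = inj₁ (U⇒even gU , h≡g)
  SameBasic⇒∼ {g} {h} (inj₂ (u , uU , (a , aA₀ , g≡ua) , (a' , a'A₀ , h≡ua'))) =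
    inj₂ (odd , same-coset (A₀-elements aA₀) (A₀-elements a'A₀))
    where
    v = u ∙ x^ 1
    odd : parity g ≡ true
    odd = begin
      parity g                                     ≡⟨ cong parity g≡ua ⟩
      parity (v ∙ a)                               ≡⟨ parity-∙ v a ⟩
      parity v xor parity a                        ≡⟨ cong (_xor parity a) (parity-∙ u (x^ 1)) ⟩
      (parity u xor parity (x^ 1)) xor parity a    ≡⟨ cong₂ (λ p q → (p xor q) xor parity a) (U⇒even uU) (trans (cong parity (x^≡⟨⟩ 1)) parity-x) ⟩
      true xor parity a                            ≡⟨ cong (true xor_) (even-A₀ (A₀-elements aA₀)) ⟩
      true                                         ∎
      where
      open ≡-Reasoning
      even-A₀ : a ≡ e ⊎ a ≡ z → parity a ≡ false
      even-A₀ (inj₁ a≡e) = trans (cong parity a≡e) parity-e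
      even-A₀ (inj₂ a≡z) = trans (cong parity a≡z) parity-z
    g≡v : a ≡ e → g ≡ v
    g≡v a≡e = trans g≡ua (trans (cong (v ∙_) a≡e) (∙-identityʳ v))
    g≡vz : a ≡ z → g ≡ v ∙ z
    g≡vz a≡z = trans g≡ua (cong (v ∙_) a≡z)
    h≡v : a' ≡ e → h ≡ v
    h≡v a'≡e = trans h≡ua' (trans (cong (v ∙_) a'≡e) (∙-identityʳ v))
    h≡vz : a' ≡ z → h ≡ v ∙ z
    h≡vz a'≡z = trans h≡ua' (cong (v ∙_) a'≡z)
    same-coset : a ≡ e ⊎ a ≡ z → a' ≡ e ⊎ a' ≡ z → h ≡ g ⊎ h ≡ g ∙ z
    same-coset (inj₁ a≡e) (inj₁ a'≡e) = inj₁ (trans (h≡v a'≡e) (sym (g≡v a≡e)))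
    same-coset (inj₂ a≡z) (inj₂ a'≡z) = inj₁ (trans (h≡vz a'≡z) (sym (g≡vz a≡z)))
    same-coset (inj₁ a≡e) (inj₂ a'≡z) = inj₂ (trans (h≡vz a'≡z) (cong (_∙ z) (sym (g≡v a≡e))))
    same-coset (inj₂ a≡z) (inj₁ a'≡e) = inj₂ (trans (h≡v a'≡e) (trans (sym (∙z-involutive v)) (cong (_∙ z) (sym (g≡vz a≡z)))))

  ∼⇒SameBasic : ∀ {g h} → g ∼ h → SameBasic g h
  ∼⇒SameBasic (inj₁ (even , h≡g)) = inj₁ (even⇒U even , h≡g)
  ∼⇒SameBasic {g} {h} (inj₂ (odd , h≡g⊎h≡gz)) =
    inj₂ (u , even⇒U even-u , (x^ (2 ℕ.* k ℕ.* 0) , (0 , refl) , g≡ux^0) , in-coset h≡g⊎h≡gz)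
    where
    u = g ∙ x^- 1
    ux≡g : u ∙ x^ 1 ≡ g
    ux≡g = trans (∙-assoc g (x^- 1) (x^ 1)) (trans (cong (g ∙_) (∙-inverseˡ (x^ 1))) (∙-identityʳ g))
    even-u : parity u ≡ false
    even-u = begin
      parity u                            ≡⟨ parity-∙ g (x^- 1) ⟩
      parity g xor parity (x^- 1)         ≡⟨ cong₂ _xor_ odd (trans (parity-⁻¹ (x^ 1)) (trans (cong parity (x^≡⟨⟩ 1)) parity-x)) ⟩
      false                               ∎
      where open ≡-Reasoning
    g≡ux^0 : g ≡ u ∙ x^ 1 ∙ x^ (2 ℕ.* k ℕ.* 0)
    g≡ux^0 = sym (trans (cong₂ _∙_ ux≡g x^2k*0≡e) (∙-identityʳ g))
    in-coset : h ≡ g ⊎ h ≡ g ∙ z → ∃ λ a → a ∈A₀ × h ≡ u ∙ x^ 1 ∙ a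
    in-coset (inj₁ h≡g)  = x^ (2 ℕ.* k ℕ.* 0) , (0 , refl) , trans h≡g g≡ux^0
    in-coset (inj₂ h≡gz) = x^ (2 ℕ.* k ℕ.* 1) , (1 , refl) , trans h≡gz (sym (cong₂ _∙_ ux≡g x^2k*1≡z))

  module Minimality {Q : G → G → Set} (Q-isSRing : IsSRing Q) (Z-union : UnionOfBasic Q _∈Z) where

    open SRingProperties k Q-isSRing

    InZ-union : UnionOfBasic Q InZ
    InZ-union g h g~h gZ = ∈Z⇒InZ (Z-union g h g~h (InZ⇒∈Z gZ))

    private
      F : G → G × G → ℕ
      F h p = 𝟙 ((InZ? (proj₁ p) ×-dec InZ? (proj₂ p)) ×-dec (proj₁ p ∙ proj₂ p ≟G h))

    pivot-count : ∀ {r h} → Pivot r h → count InZ? InZ? h ≤ 2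
    pivot-count {r} {h} r-pivot = ∑≤length pairs-enumerate ((r , r ⁻¹ ∙ h) ∷ (h ∙ r ⁻¹ , r) ∷ []) bound
      where
      bound : ∀ p → F h p ≤ 𝟙 ((r , r ⁻¹ ∙ h) ≟² p) ℕ.+ (𝟙 ((h ∙ r ⁻¹ , r) ≟² p) ℕ.+ 0)
      bound (a , b) = by-factorisation ((InZ? a ×-dec InZ? b) ×-dec (a ∙ b ≟G h))
        where
        by-factorisation : (D : Dec ((InZ a × InZ b) × a ∙ b ≡ h)) →
                           𝟙 D ≤ 𝟙 ((r , r ⁻¹ ∙ h) ≟² (a , b)) ℕ.+ (𝟙 ((h ∙ r ⁻¹ , r) ≟² (a , b)) ℕ.+ 0)
        by-factorisation (no _) = z≤n
        by-factorisation (yes ((aZ , bZ) , ab≡h)) with r-pivot aZ bZ ab≡h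
        ... | inj₁ a≡r = subst (λ v → 1 ≤ v ℕ.+ (𝟙 ((h ∙ r ⁻¹ , r) ≟² (a , b)) ℕ.+ 0)) (sym (𝟙-yes ((r , r ⁻¹ ∙ h) ≟² (a , b))
                           (cong₂ _,_ (sym a≡r) (sym (trans (y≈x\\z a b h ab≡h) (cong (λ c → c ⁻¹ ∙ h) a≡r)))))) (s≤s z≤n)
        ... | inj₂ b≡r = subst (λ v → 1 ≤ 𝟙 ((r , r ⁻¹ ∙ h) ≟² (a , b)) ℕ.+ (v ℕ.+ 0)) (sym (𝟙-yes ((h ∙ r ⁻¹ , r) ≟² (a , b))
                           (cong₂ _,_ (sym (trans (x≈z//y a b h ab≡h) (cong (λ c → h ∙ c ⁻¹) b≡r))) (sym b≡r)))) (ℕ.m≤n+m 1 _)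

    x² : G
    x² = ⟨ + 2 , false ⟩

    private
      y⁰ x⁻² yx⁻⁴ : G
      y⁰   = ⟨ + 0 , true ⟩
      x⁻²  = ⟨ - + 2 , false ⟩
      yx⁻⁴ = ⟨ - + 4 , true ⟩

      y⁰∈Z : InZ y⁰
      y⁰∈Z = reflection (π-⟨⟩ (+ 0) true) (apart-by-2K-2 (+ 0) (+ 2 * K - + 2) true (sym (+-identityˡ _)))

      yx⁻⁴∈Z : InZ yx⁻⁴
      yx⁻⁴∈Z = reflection (π-⟨⟩ (- + 4) true) (apart-by-2K+2 (- + 4) (+ 2 * K - + 2) true (eq K))
        where
        eq : ∀ K → + 2 * K - + 2 ≡ - + 4 + (+ 2 * K + + 2)
        eq = solve-∀

    count-t≥3 : 3 ≤ count InZ? InZ? t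
    count-t≥3 = length≤∑ pairs-enumerate (p₁ ∷ p₂ ∷ p₃ ∷ []) bound
      where
      p₁ p₂ p₃ : G × G
      p₁ = x² , y⁰
      p₂ = y⁰ , x⁻²
      p₃ = yx⁻⁴ , x²
      F[p₁] : F t p₁ ≡ 1
      F[p₁] = 𝟙-yes ((InZ? x² ×-dec InZ? y⁰) ×-dec (x² ∙ y⁰ ≟G t)) ((rotation (π-⟨⟩ (+ 2) false) , y⁰∈Z) , ⟨⟩-∙ (+ 2) false (+ 0) true)
      F[p₂] : F t p₂ ≡ 1
      F[p₂] = 𝟙-yes ((InZ? y⁰ ×-dec InZ? x⁻²) ×-dec (y⁰ ∙ x⁻² ≟G t)) ((y⁰∈Z , rotation (π-⟨⟩ (- + 2) false)) , ⟨⟩-∙ (+ 0) true (- + 2) false)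
      F[p₃] : F t p₃ ≡ 1
      F[p₃] = 𝟙-yes ((InZ? yx⁻⁴ ×-dec InZ? x²) ×-dec (yx⁻⁴ ∙ x² ≟G t)) ((yx⁻⁴∈Z , rotation (π-⟨⟩ (+ 2) false)) , ⟨⟩-∙ (- + 4) true (+ 2) false)
      p₁≢p₂ : p₁ ≢ p₂
      p₁≢p₂ eq = contradiction (cong (bit ∘ proj₁) eq) λ ()
      p₁≢p₃ : p₁ ≢ p₃
      p₁≢p₃ eq = contradiction (cong (bit ∘ proj₁) eq) λ ()
      p₂≢p₃ : p₂ ≢ p₃
      p₂≢p₃ eq = apart-by-4 (- + 4) (+ 0) true refl (sym (cong proj₁ eq))
      bound : ∀ p → 𝟙 (p₁ ≟² p) ℕ.+ (𝟙 (p₂ ≟² p) ℕ.+ (𝟙 (p₃ ≟² p) ℕ.+ 0)) ≤ F t p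
      bound p = at-most-one (p₁ ≟² p) (p₂ ≟² p) (p₃ ≟² p)
        where
        at-most-one : (d₁ : Dec (p₁ ≡ p)) (d₂ : Dec (p₂ ≡ p)) (d₃ : Dec (p₃ ≡ p)) → 𝟙 d₁ ℕ.+ (𝟙 d₂ ℕ.+ (𝟙 d₃ ℕ.+ 0)) ≤ F t p
        at-most-one (yes e₁) (yes e₂) _        = contradiction (trans e₁ (sym e₂)) p₁≢p₂
        at-most-one (yes e₁) (no _)   (yes e₃) = contradiction (trans e₁ (sym e₃)) p₁≢p₃
        at-most-one (no _)   (yes e₂) (yes e₃) = contradiction (trans e₂ (sym e₃)) p₂≢p₃
        at-most-one (yes e₁) (no _)   (no _)   = ℕ.≤-reflexive (sym (trans (cong (F t) (sym e₁)) F[p₁]))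
        at-most-one (no _)   (yes e₂) (no _)   = ℕ.≤-reflexive (sym (trans (cong (F t) (sym e₂)) F[p₂]))
        at-most-one (no _)   (no _)   (yes e₃) = ℕ.≤-reflexive (sym (trans (cong (F t) (sym e₃)) F[p₃]))
        at-most-one (no _)   (no _)   (no _)   = z≤n

    thin-t : Thin t
    thin-t h t~h with h ≟G t
    ... | yes h≡t = h≡t
    ... | no  h≢t = contradiction (ℕ.≤-trans count-t≥3 (ℕ.≤-reflexive (count-invariant InZ? InZ? InZ-union InZ-union t~h)))
                                  (ℕ.<⇒≱ (s≤s (pivot-count (proj₂ (pivot (InZ-union t h t~h t∈Z) h≢t)))))
      where
      t∈Z : InZ t
      t∈Z = is-t refl

    Z⁺ : G → Set
    Z⁺ g = InZ g × g ≢ t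

    Z⁺-union : UnionOfBasic Q Z⁺
    Z⁺-union = union-× InZ-union (union-≢ thin-t)

    Exceptional : G → Set
    Exceptional g = Z⁺ g × ¬ Z⁺ (t ∙ g)

    Exceptional-union : UnionOfBasic Q Exceptional
    Exceptional-union = union-× Z⁺-union (union-¬ (union-translateˡ thin-t Z⁺-union))

    private
      π-t∙ : ∀ {h σ} → π h ≡ σ → π (t ∙ h) ≡ D₈.⟨ - + 2 , true ⟩ D₈.∙ σ
      π-t∙ {h} πh = trans (π-∙ t h) (cong₂ D₈._∙_ (π-⟨⟩ (- + 2) true) πh)

      t≢ : ∀ {g σ} → π g ≡ σ → σ ≢ D₈.⟨ - + 2 , true ⟩ → g ≢ t
      t≢ πg σ≢ g≡t = σ≢ (trans (sym πg) (trans (cong π g≡t) (π-⟨⟩ (- + 2) true)))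

    exceptional-cases : ∀ {h} → Exceptional h → h ≡ z ⊎ h ≡ s₁ ⊎ h ≡ s₂
    exceptional-cases {h} ((rotation πh , _) , t∙h∉Z⁺) = by-decision (h ≟G z)
      where
      by-decision : Dec (h ≡ z) → h ≡ z ⊎ h ≡ s₁ ⊎ h ≡ s₂
      by-decision (yes h≡z) = inj₁ h≡z
      by-decision (no h≢z)  = contradiction
        (reflection (π-t∙ πh) (λ th≡w₀ → h≢z (trans (right-factor th≡w₀) t∙w₀≡z)) , t≢ (π-t∙ πh) λ ())
        t∙h∉Z⁺
    exceptional-cases ((reflection πh _ , _) , t∙h∉Z⁺) = contradiction (rotation (π-t∙ πh) , t≢ (π-t∙ πh) λ ()) t∙h∉Z⁺
    exceptional-cases ((is-s₁ h≡s₁ , _) , _)    = inj₂ (inj₁ h≡s₁)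
    exceptional-cases ((is-t h≡t , h≢t) , _)    = contradiction h≡t h≢t
    exceptional-cases ((is-s₂ h≡s₂ , _) , _)    = inj₂ (inj₂ h≡s₂)

    exceptional-z : Exceptional z
    exceptional-z = (rotation π-z , t≢ π-z λ ()) , λ (tzZ , _) → reflection-by-signature tzZ (trans (cong π t∙z≡w₀) π-w₀) t∙z≡w₀

    exceptional-s₁ : Exceptional s₁
    exceptional-s₁ = (is-s₁ refl , t≢ π-s₁ λ ()) , λ (ts₁Z , _) → ∉Z (π-t∙ π-s₁) _ ts₁Z

    Central : G → Set
    Central g = Exceptional g × Z⁺ ((t ∙ g) ∙ t)

    Central-union : UnionOfBasic Q Central
    Central-union = union-× Exceptional-union (union-translateˡ thin-t (union-translateʳ thin-t Z⁺-union))

    central-z : Central z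
    central-z = exceptional-z , subst Z⁺ (sym t∙z∙t≡z) (proj₁ exceptional-z)

    central-unique : ∀ {h} → Central h → h ≡ z
    central-unique (h-exc , tht∈Z⁺) with exceptional-cases h-exc
    ... | inj₁ h≡z          = h≡z
    ... | inj₂ (inj₁ h≡s₁)  = contradiction (subst (λ h → Z⁺ ((t ∙ h) ∙ t)) h≡s₁ tht∈Z⁺) ts₁t∉Z⁺
      where
      ts₁t∉Z⁺ : ¬ Z⁺ ((t ∙ s₁) ∙ t)
      ts₁t∉Z⁺ (ts₁tZ , _) = apart-by-2K+2 (- (+ 2 * K) - + 3) (- + 1) true (eq₃ K) (trans (sym ts₁t≡⟨⟩) (s₂-by-signature ts₁tZ πts₁t))
        where
        eq₁ : ∀ K → - - + 2 + (+ 2 * K - + 1) ≡ + 2 * K + + 1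
        eq₁ = solve-∀
        eq₂ : ∀ K → - (+ 2 * K + + 1) + - + 2 ≡ - (+ 2 * K) - + 3
        eq₂ = solve-∀
        eq₃ : ∀ K → - + 1 ≡ - (+ 2 * K) - + 3 + (+ 2 * K + + 2)
        eq₃ = solve-∀
        ts₁t≡⟨⟩ : (t ∙ s₁) ∙ t ≡ ⟨ - (+ 2 * K) - + 3 , true ⟩
        ts₁t≡⟨⟩ = trans (cong (_∙ t) (⟨⟩-∙-≡ (- + 2) true (+ 2 * K - + 1) true (+ 2 * K + + 1) (≡⇒≡-mod (eq₁ K))))
                        (⟨⟩-∙-≡ (+ 2 * K + + 1) false (- + 2) true (- (+ 2 * K) - + 3) (≡⇒≡-mod (eq₂ K)))
        πts₁t : π ((t ∙ s₁) ∙ t) ≡ D₈.⟨ + 3 , true ⟩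
        πts₁t = trans (π-∙ (t ∙ s₁) t) (cong₂ D₈._∙_ (π-t∙ π-s₁) (π-⟨⟩ (- + 2) true))
    ... | inj₂ (inj₂ h≡s₂)  = contradiction (subst (λ h → Z⁺ ((t ∙ h) ∙ t)) h≡s₂ tht∈Z⁺) ts₂t∉Z⁺
      where
      ts₂t∉Z⁺ : ¬ Z⁺ ((t ∙ s₂) ∙ t)
      ts₂t∉Z⁺ (ts₂tZ , _) = apart-by-2K+2 (- + 3) (+ 2 * K - + 1) true (eq K) (trans (sym ts₂t≡⟨⟩) (s₁-by-signature ts₂tZ πts₂t))
        where
        ts₂t≡⟨⟩ : (t ∙ s₂) ∙ t ≡ ⟨ - + 3 , true ⟩
        ts₂t≡⟨⟩ = trans (cong (_∙ t) (⟨⟩-∙ (- + 2) true (- + 1) true)) (⟨⟩-∙ (+ 1) false (- + 2) true)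
        πts₂t : π ((t ∙ s₂) ∙ t) ≡ D₈.⟨ + 1 , true ⟩
        πts₂t = trans (π-∙ (t ∙ s₂) t) (cong₂ D₈._∙_ (π-t∙ (π-⟨⟩ (- + 1) true)) (π-⟨⟩ (- + 2) true))
        eq : ∀ K → + 2 * K - + 1 ≡ - + 3 + (+ 2 * K + + 2)
        eq = solve-∀

    thin-z : Thin z
    thin-z h z~h = central-unique (Central-union z h z~h central-z)

    S : G → Set
    S g = Exceptional g × g ≢ z

    S-union : UnionOfBasic Q S
    S-union = union-× Exceptional-union (union-≢ thin-z)

    s₁∈S : S s₁
    s₁∈S = exceptional-s₁ , λ s₁≡z → contradiction (cong bit s₁≡z) λ ()

    S-cases : ∀ {g} → S g → g ≡ s₁ ⊎ g ≡ s₂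
    S-cases (g-exc , g≢z) with exceptional-cases g-exc
    ... | inj₁ g≡z       = contradiction g≡z g≢z
    ... | inj₂ s₁⊎s₂     = s₁⊎s₂

    X : G → Set
    X = (_≡ t ∙ z) ∙ˢ S

    X-union : UnionOfBasic Q X
    X-union = ∙ˢ-union (union-≡ (thin-∙ thin-t thin-z)) S-union

    x∈X : X x
    x∈X = t ∙ z , s₁ , refl , s₁∈S , t∙z∙s₁≡x

    X-cases : ∀ {g} → X g → g ≡ x ⊎ g ≡ x ∙ z
    X-cases (a , b , a≡tz , bS , ab≡g) with S-cases bS
    ... | inj₁ b≡s₁ = inj₁ (trans (sym ab≡g) (trans (cong₂ _∙_ a≡tz b≡s₁) t∙z∙s₁≡x))
    ... | inj₂ b≡s₂ = inj₂ (trans (sym ab≡g) (trans (cong₂ _∙_ a≡tz b≡s₂) t∙z∙s₂≡x∙z))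

    private
      x∙x≡x² : x ∙ x ≡ x²
      x∙x≡x² = ⟨⟩-∙ (+ 1) false (+ 1) false

      x²∙z∉Z : ¬ InZ (x² ∙ z)
      x²∙z∉Z = ∉Z (trans (π-∙ x² z) (cong₂ D₈._∙_ (π-⟨⟩ (+ 2) false) π-z)) _

    XX-cases : ∀ {g} → (X ∙ˢ X) g → g ≡ x² ⊎ g ≡ x² ∙ z
    XX-cases {g} (a , b , aX , bX , ab≡g) = by-cases (X-cases aX) (X-cases bX)
      where
      open ≡-Reasoning
      by-cases : a ≡ x ⊎ a ≡ x ∙ z → b ≡ x ⊎ b ≡ x ∙ z → g ≡ x² ⊎ g ≡ x² ∙ z
      by-cases (inj₁ a≡x)  (inj₁ b≡x)  = inj₁ (begin
        g                   ≡⟨ ab≡g ⟨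
        a ∙ b               ≡⟨ cong₂ _∙_ a≡x b≡x ⟩
        x ∙ x               ≡⟨ x∙x≡x² ⟩
        x²                  ∎)
      by-cases (inj₁ a≡x)  (inj₂ b≡xz) = inj₂ (begin
        g                   ≡⟨ ab≡g ⟨
        a ∙ b               ≡⟨ cong₂ _∙_ a≡x b≡xz ⟩
        x ∙ (x ∙ z)         ≡⟨ ∙-assoc x x z ⟨
        (x ∙ x) ∙ z         ≡⟨ cong (_∙ z) x∙x≡x² ⟩
        x² ∙ z              ∎)
      by-cases (inj₂ a≡xz) (inj₁ b≡x)  = inj₂ (begin
        g                   ≡⟨ ab≡g ⟨
        a ∙ b               ≡⟨ cong₂ _∙_ a≡xz b≡x ⟩
        (x ∙ z) ∙ x         ≡⟨ ∙z∙≡∙∙z x x ⟩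
        (x ∙ x) ∙ z         ≡⟨ cong (_∙ z) x∙x≡x² ⟩
        x² ∙ z              ∎)
      by-cases (inj₂ a≡xz) (inj₂ b≡xz) = inj₁ (begin
        g                   ≡⟨ ab≡g ⟨
        a ∙ b               ≡⟨ cong₂ _∙_ a≡xz b≡xz ⟩
        (x ∙ z) ∙ (x ∙ z)   ≡⟨ ∙-assoc (x ∙ z) x z ⟨
        ((x ∙ z) ∙ x) ∙ z   ≡⟨ cong (_∙ z) (∙z∙≡∙∙z x x) ⟩
        ((x ∙ x) ∙ z) ∙ z   ≡⟨ ∙z-involutive (x ∙ x) ⟩
        x ∙ x               ≡⟨ x∙x≡x² ⟩
        x²                  ∎)

    Square : G → Set
    Square g = InZ g × (X ∙ˢ X) g

    Square-union : UnionOfBasic Q Square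
    Square-union = union-× InZ-union (∙ˢ-union X-union X-union)

    square-unique : ∀ {h} → Square h → h ≡ x²
    square-unique (hZ , hXX) with XX-cases hXX
    ... | inj₁ h≡x²  = h≡x²
    ... | inj₂ h≡x²z = contradiction (subst InZ h≡x²z hZ) x²∙z∉Z

    thin-x² : Thin x²
    thin-x² h x²~h = square-unique (Square-union x² h x²~h (rotation (π-⟨⟩ (+ 2) false) , x , x , x∈X , x∈X , x∙x≡x²))

    thin-x^2m : ∀ m → Thin (x^ (2 ℕ.* m))
    thin-x^2m ℕ.zero    = thin-e
    thin-x^2m (ℕ.suc m) = subst Thin (trans (x^-∙-x^ (2 ℕ.* m) 2) (cong x^ (sym (trans (ℕ.*-suc 2 m) (ℕ.+-comm 2 (2 ℕ.* m))))))
                                 (thin-∙ (thin-x^2m m) (subst Thin (sym (x^≡⟨⟩ 2)) thin-x²))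

    thin-even-rotation : ∀ {g} → bit g ≡ false → parity g ≡ false → Thin g
    thin-even-rotation {g} rot even = subst Thin (trans (cong x^ m≡2q) (rotation-η rot)) (thin-x^2m (toℕ (proj₁ g) ℕ./ 2))
      where
      m≡2q : 2 ℕ.* (toℕ (proj₁ g) ℕ./ 2) ≡ toℕ (proj₁ g)
      m≡2q = sym (residue-decompose 2 (subst (λ p → exp g ≡ + ⌊ p ⌋ [mod + 2 ]) even (parity-spec g)) (s≤s z≤n))

    thin-even : ∀ {g} → parity g ≡ false → Thin g
    thin-even {g} even = by-bit (bit g) refl
      where
      by-bit : ∀ β → bit g ≡ β → Thin g
      by-bit false rot = thin-even-rotation rot even
      by-bit true  ref = subst Thin (trans (sym (∙-assoc t t g)) (trans (cong (_∙ g) t∙t≡e) (∙-identityˡ g)))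
                           (thin-∙ thin-t (thin-even-rotation {t ∙ g} (trans (bit-∙ t g) (cong (true xor_) ref)) (trans (parity-∙ t g) (cong₂ _xor_ parity-t even))))

    minimal : ∀ {g h} → Q g h → g ∼ h
    minimal {g} {h} g~h = by-parity (parity g) refl
      where
      by-parity : ∀ p → parity g ≡ p → g ∼ h
      by-parity false even = inj₁ (even , thin-even even h g~h)
      by-parity true  odd  = inj₂ (odd , in-coset (coset-union g h g~h (u , x , refl , x∈X , ux≡g)))
        where
        u = g ∙ x ⁻¹
        ux≡g : u ∙ x ≡ g
        ux≡g = //-rightDividesˡ x g
        even-u : parity u ≡ false
        even-u = trans (parity-∙ g (x ⁻¹)) (cong₂ _xor_ odd (trans (parity-⁻¹ x) parity-x))
        coset-union : UnionOfBasic Q ((_≡ u) ∙ˢ X)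
        coset-union = ∙ˢ-union (union-≡ (thin-even even-u)) X-union
        in-coset : ((_≡ u) ∙ˢ X) h → h ≡ g ⊎ h ≡ g ∙ z
        in-coset (a , b , a≡u , bX , ab≡h) with X-cases bX
        ... | inj₁ b≡x  = inj₁ (trans (sym ab≡h) (trans (cong₂ _∙_ a≡u b≡x) ux≡g))
        ... | inj₂ b≡xz = inj₂ (trans (sym ab≡h) (trans (cong₂ _∙_ a≡u b≡xz) (trans (sym (∙-assoc u x z)) (cong (_∙ z) ux≡g))))

lemma5p2 : (k : ℕ) .{{_ : NonZero k}} → 3 ≤ k → ¬ (2 ∣ k) →
    Dihedral.IsWLClosure k (Dihedral.SameBasic k) (Dihedral._∈Z k)
lemma5p2 k k≥3 k-odd = SameBasic-isSRing , Z-union , minimality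
  where
  open Proof k k≥3 k-odd
  open SRings using (isSRing-resp-⇔)

  SameBasic-isSRing : IsSRing SameBasic
  SameBasic-isSRing = isSRing-resp-⇔ k ∼⇒SameBasic SameBasic⇒∼ ∼-isSRing

  Z-union : UnionOfBasic SameBasic _∈Z
  Z-union g h g≈h gZ = InZ⇒∈Z (∼-Z g h (SameBasic⇒∼ g≈h) (∈Z⇒InZ gZ))

  minimality : ∀ Q → IsSRing Q → UnionOfBasic Q _∈Z → ∀ g h → Q g h → SameBasic g h
  minimality Q Q-isSRing Q-Z g h g~h = ∼⇒SameBasic (Minimality.minimal Q-isSRing Q-Z g~h)
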